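{- For all integers $n,p\ge 1$ with $p\le n$ and $n-p$ even, $\mu(T(n,p))=\frac{1}{30\,(n^{2}+8n-p^{2}+4)\,(n^{2}+8n-p^{2}+8)}\Bigl(11n^{5}+220n^{4}-30n^{3}p^{2}+1400n^{3}+20n^{2}p^{3}-360n^{2}p^{2}-20n^{2}p+3440n^{2}-5np^{4}+160np^{3}-880np^{2}-160np+3344n+4p^{5}-20p^{4}+140p^{3}-400p^{2}-144p+960\Bigr).$
   Context: For a connected graph $G$ on $N\ge 2$ vertices, $W(G)=\sum_{\{u,v\}\subseteq V(G)} d_G(u,v)$ (unordered pairs of distinct vertices) and the average distance is $\mu(G)=\frac{2W(G)}{N(N-1)}$. The trapezium square-cell configuration $T(n,p)$ (defined for $p\le n$, $n-p$ even) is the subgraph of the square lattice formed as follows: let $a=(n-p)/2$ and for integers $x,r$ let $C(x,r)=[x,x+1]\times[r,r+1]$; take cell rows $r=0,\dots,a$ with $L_r=-r$, $R_r=p-1+r$ for $0\le r\le a-1$ and $L_a=-a$, $R_a=-a+n-1$; $T(n,p)$ is the graph whose vertices are the corners and whose edges are the sides of the squares $C(x,r)$ with $L_r\le x\le R_r$ (cell rows of widths $p,p+2,\dots,n-2,n$, each centered on the previous; it has $\tfrac14(n^2-p^2+8n+8)$ vertices). -}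

module Defs where

open import Data.Bool using (Bool; true; false; _∧_; _∨_; not; if_then_else_)
open import Data.Nat as ℕ using (ℕ; zero; suc)
open import Data.Integer as ℤ using (ℤ; +_; -_; _-_)
open import Data.List using (List; []; _∷_; map; concatMap; filter; length; upTo)
open import Data.Bool.ListAction using (any)
open import Data.Nat.ListAction using (sum)
open import Data.Product using (_×_; _,_; proj₁; proj₂)
open import Relation.Nullary.Decidable using (⌊_⌋; yes; no)
open import Data.Rational as ℚ using (ℚ; 0ℚ; _÷_)

Point : Set
Point = ℤ × ℤ

infix 4 _≤ᵇ_ _==_
_≤ᵇ_ : ℤ → ℤ → Bool
x ≤ᵇ y = ⌊ x ℤ.≤? y ⌋

_==_ : ℤ → ℤ → Bool
x == y = ⌊ x ℤ.≟ y ⌋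

samePt : Point → Point → Bool
samePt (x , y) (x' , y') = (x == x') ∧ (y == y')

aOf : ℕ → ℕ → ℕ
aOf n p = (n ℕ.∸ p) ℕ./ 2

Lb : ℕ → ℕ → ℤ → ℤ
Lb n p r = - r

Rb : ℕ → ℕ → ℤ → ℤ
Rb n p r = if r == (+ aOf n p)
           then (- (+ aOf n p)) ℤ.+ (+ n) - + 1
           else (+ p) - + 1 ℤ.+ r

-- Is the unit square C(x,r) = [x,x+1]×[r,r+1] one of the cells of T(n,p)?
isCell : ℕ → ℕ → ℤ → ℤ → Bool
isCell n p x r = ((+ 0) ≤ᵇ r) ∧ (r ≤ᵇ (+ aOf n p)) ∧ (Lb n p r ≤ᵇ x) ∧ (x ≤ᵇ Rb n p r)

isVertex : ℕ → ℕ → Point → Bool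
isVertex n p (x , y) =
  isCell n p x y ∨ isCell n p (x - + 1) y ∨ isCell n p x (y - + 1) ∨ isCell n p (x - + 1) (y - + 1)

-- Edges: unit segments which are sides of some cell
-- horizontal segment (x,y)–(x+1,y): bottom of C(x,y) or top of C(x,y-1)
-- vertical segment (x,y)–(x,y+1): left side of C(x,y) or right side of C(x-1,y)
adj : ℕ → ℕ → Point → Point → Bool
adj n p (x , y) (x' , y') =
     ((y == y') ∧ (x' == x ℤ.+ + 1) ∧ hor x y)
  ∨ ((y == y') ∧ (x == x' ℤ.+ + 1) ∧ hor x' y)
  ∨ ((x == x') ∧ (y' == y ℤ.+ + 1) ∧ ver x y)
  ∨ ((x == x') ∧ (y == y' ℤ.+ + 1) ∧ ver x y')
  where
    hor : ℤ → ℤ → Bool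
    hor u v = isCell n p u v ∨ isCell n p u (v - + 1)
    ver : ℤ → ℤ → Bool
    ver u v = isCell n p u v ∨ isCell n p (u - + 1) v

-- Candidate points: y ∈ [0, a+1], x ∈ [-a, -a+n]  (all corners lie there)
candidates : ℕ → ℕ → List Point
candidates n p =
  concatMap (λ j → map (λ i → ((- (+ aOf n p)) ℤ.+ + i , + j)) (upTo (suc n)))
            (upTo (suc (suc (aOf n p))))

vertices : ℕ → ℕ → List Point
vertices n p = filter (λ v → isVertex n p v ≟ᵇ) (candidates n p)
  where
    open import Data.Bool.Properties using () renaming (T? to _≟ᵇ)

numV : ℕ → ℕ → ℕ
numV n p = length (vertices n p)

reach : ℕ → ℕ → ℕ → Point → Point → Bool
reach n p zero    u v = samePt u v
reach n p (suc k) u v = reach n p k u v ∨ any (λ w → reach n p k u w ∧ adj n p w v) (vertices n p)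

-- Graph distance: the least k with a walk of length ≤ k (searched up to N;
-- in a connected graph on N vertices the distance is < N, so the fallback value
-- N is never used)
distFrom : ℕ → ℕ → Point → Point → ℕ → ℕ → ℕ
distFrom n p u v k zero = k
distFrom n p u v k (suc fuel) = if reach n p k u v then k else distFrom n p u v (suc k) fuel

dist : ℕ → ℕ → Point → Point → ℕ
dist n p u v = distFrom n p u v 0 (numV n p)

pairSum : (Point → Point → ℕ) → List Point → ℕ
pairSum d []       = 0
pairSum d (x ∷ xs) = sum (map (d x) xs) ℕ.+ pairSum d xs

wiener : ℕ → ℕ → ℕ
wiener n p = pairSum (dist n p) (vertices n p)

-- Division on ℚ (total; value 0 for zero denominator, which never occurs below)
infixl 7 _÷'_
_÷'_ : ℚ → ℚ → ℚ
x ÷' y with y ℚ.≟ 0ℚ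
... | yes _ = 0ℚ
... | no y≢0 = _÷_ x y {{ℚ.≢-nonZero y≢0}}

avgDist : ℕ → ℕ → ℚ
avgDist n p = ((+ (2 ℕ.* wiener n p)) ℚ./ 1) ÷' ((+ (numV n p ℕ.* (numV n p ℕ.∸ 1))) ℚ./ 1)

module Submission where

-- Translated by a to the right, the vertices of T(p + 2a, p) are the points (i , j) of ℕ² with
-- j ≤ a + 1, a ≤ i + j, i ≤ a + p + j and i ≤ 2a + p: the bottom row [a , a + p] × {0} with a
-- copy of T(p + 2a, p + 2) raised on top of it. Each row is an interval, no shorter than the
-- row below, so two vertices are always joined by a monotone lattice path inside the trapezium
-- and the graph distance is the Manhattan distance. Splitting the Wiener index W along the
-- bottom row, and summing |i - j| over intervals in closed form, gives by induction on a
-- polynomials for 60 W and for the number N of vertices; the formula is 2W / (N (N - 1)) with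
-- n = p + 2a.

open import Data.Nat.Base using (ℕ; _≤_)
open import Relation.Binary.PropositionalEquality using (_≡_; refl)

cong₃ : ∀ {A B C D : Set} (f : A → B → C → D) {x x′ y y′ z z′} →
        x ≡ x′ → y ≡ y′ → z ≡ z′ → f x y z ≡ f x′ y′ z′
cong₃ f refl refl refl = refl

module Sums where

  open import Data.Nat
  open import Data.Nat.Properties
  open import Data.Nat.Tactic.RingSolver
  open import Data.Nat.ListAction using (sum)
  open import Data.Nat.ListAction.Properties using (sum-++)
  open import Algebra.Properties.CommutativeSemigroup +-commutativeSemigroup using (interchange)
  open import Data.List using (List; []; _∷_; _++_; [_]; map; length)
  open import Data.List.Properties using (map-++; map-cong; map-cong-local; map-∘)
  open import Data.List.Relation.Unary.All as All using (All)
  open import Function using (_∘_)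
  open import Relation.Binary.PropositionalEquality hiding ([_])
  open ≡-Reasoning

  private variable
    A B C D : Set

  pairSum : (A → A → ℕ) → List A → ℕ
  pairSum d []       = 0
  pairSum d (x ∷ xs) = sum (map (d x) xs) + pairSum d xs

  crossSum : (A → B → ℕ) → List A → List B → ℕ
  crossSum d xs ys = sum (map (λ x → sum (map (d x) ys)) xs)

  sum-map-cong : {f g : A → ℕ} → (∀ x → f x ≡ g x) → ∀ xs → sum (map f xs) ≡ sum (map g xs)
  sum-map-cong f≗g xs = cong sum (map-cong f≗g xs)

  sum-map-+ : (f g : A → ℕ) (xs : List A) →
              sum (map (λ x → f x + g x) xs) ≡ sum (map f xs) + sum (map g xs)
  sum-map-+ f g []       = refl
  sum-map-+ f g (x ∷ xs) = begin
    f x + g x + sum (map (λ x → f x + g x) xs)  ≡⟨ cong (f x + g x +_) (sum-map-+ f g xs) ⟩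
    f x + g x + (sum (map f xs) + sum (map g xs)) ≡⟨ interchange (f x) (g x) _ _ ⟩
    f x + sum (map f xs) + (g x + sum (map g xs)) ∎

  sum-map-++ : (f : A → ℕ) (xs ys : List A) → sum (map f (xs ++ ys)) ≡ sum (map f xs) + sum (map f ys)
  sum-map-++ f xs ys = trans (cong sum (map-++ f xs ys)) (sum-++ (map f xs) (map f ys))

  sum-map-∘ : (f : B → ℕ) (g : A → B) (xs : List A) → sum (map f (map g xs)) ≡ sum (map (f ∘ g) xs)
  sum-map-∘ f g xs = cong sum (sym (map-∘ xs))

  sum-map-const : (c : ℕ) (xs : List A) → sum (map (λ _ → c) xs) ≡ length xs * c
  sum-map-const c []       = refl
  sum-map-const c (x ∷ xs) = cong (c +_) (sum-map-const c xs)

  sum-map-suc : (f : A → ℕ) (xs : List A) → sum (map (suc ∘ f) xs) ≡ sum (map f xs) + length xs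
  sum-map-suc f []       = refl
  sum-map-suc f (x ∷ xs) = begin
    suc (f x + sum (map (suc ∘ f) xs)) ≡⟨ cong (λ s → suc (f x + s)) (sum-map-suc f xs) ⟩
    suc (f x + (sum (map f xs) + length xs)) ≡⟨ cong suc (sym (+-assoc (f x) _ _)) ⟩
    suc (f x + sum (map f xs) + length xs) ≡⟨ sym (+-suc _ _) ⟩
    f x + sum (map f xs) + suc (length xs) ∎

  crossSum-+ : (d₁ d₂ : A → B → ℕ) (xs : List A) (ys : List B) →
               crossSum (λ x y → d₁ x y + d₂ x y) xs ys ≡ crossSum d₁ xs ys + crossSum d₂ xs ys
  crossSum-+ d₁ d₂ xs ys =
    trans (sum-map-cong (λ x → sum-map-+ (d₁ x) (d₂ x) ys) xs)
          (sum-map-+ (λ x → sum (map (d₁ x) ys)) (λ x → sum (map (d₂ x) ys)) xs)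

  crossSum-++ʳ : (d : A → B → ℕ) (xs : List A) (ys zs : List B) →
                 crossSum d xs (ys ++ zs) ≡ crossSum d xs ys + crossSum d xs zs
  crossSum-++ʳ d xs ys zs =
    trans (sum-map-cong (λ x → sum-map-++ (d x) ys zs) xs)
          (sum-map-+ (λ x → sum (map (d x) ys)) (λ x → sum (map (d x) zs)) xs)

  crossSum-∷ʳ : (d : A → B → ℕ) (xs : List A) (y : B) (ys : List B) →
                crossSum d xs (y ∷ ys) ≡ sum (map (λ x → d x y) xs) + crossSum d xs ys
  crossSum-∷ʳ d xs y ys = sum-map-+ (λ x → d x y) (λ x → sum (map (d x) ys)) xs

  crossSum-[]ʳ : (d : A → B → ℕ) (xs : List A) (y : B) → crossSum d xs [ y ] ≡ sum (map (λ x → d x y) xs)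
  crossSum-[]ʳ d xs y = sum-map-cong (λ x → +-identityʳ (d x y)) xs

  crossSum-constʳ : (g : B → ℕ) (xs : List A) (ys : List B) →
                    crossSum (λ _ y → g y) xs ys ≡ length xs * sum (map g ys)
  crossSum-constʳ g xs ys = sum-map-const (sum (map g ys)) xs

  crossSum-map : (d : C → D → ℕ) (f : A → C) (g : B → D) (xs : List A) (ys : List B) →
                 crossSum d (map f xs) (map g ys) ≡ crossSum (λ x y → d (f x) (g y)) xs ys
  crossSum-map d f g xs ys =
    trans (sum-map-∘ (λ x → sum (map (d x) (map g ys))) f xs)
          (sum-map-cong (λ x → sum-map-∘ (d (f x)) g ys) xs)

  crossSum-mapʳ : (d : A → C → ℕ) (g : B → C) (xs : List A) (ys : List B) →
                  crossSum d xs (map g ys) ≡ crossSum (λ x y → d x (g y)) xs ys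
  crossSum-mapʳ d g xs ys = sum-map-cong (λ x → sum-map-∘ (d x) g ys) xs

  crossSum-self : (d : A → A → ℕ) → (∀ x → d x x ≡ 0) → (∀ x y → d x y ≡ d y x) →
                  ∀ xs → crossSum d xs xs ≡ 2 * pairSum d xs
  crossSum-self d d-refl d-sym []       = refl
  crossSum-self d d-refl d-sym (x ∷ xs) = begin
    d x x + S + crossSum d xs (x ∷ xs)
      ≡⟨ cong₂ (λ u v → u + S + v) (d-refl x) (crossSum-∷ʳ d xs x xs) ⟩
    S + (sum (map (λ y → d y x) xs) + crossSum d xs xs)
      ≡⟨ cong₂ (λ u v → S + (u + v)) (sum-map-cong (λ y → d-sym y x) xs) (crossSum-self d d-refl d-sym xs) ⟩
    S + (S + 2 * pairSum d xs)
      ≡⟨ double-+ S (pairSum d xs) ⟩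
    2 * (S + pairSum d xs) ∎
    where
      S = sum (map (d x) xs)
      double-+ : ∀ s t → s + (s + 2 * t) ≡ 2 * (s + t)
      double-+ = solve-∀

  pairSum-++ : (d : A → A → ℕ) (xs ys : List A) →
               pairSum d (xs ++ ys) ≡ pairSum d xs + crossSum d xs ys + pairSum d ys
  pairSum-++ d []       ys = refl
  pairSum-++ d (x ∷ xs) ys = begin
    sum (map (d x) (xs ++ ys)) + pairSum d (xs ++ ys)
      ≡⟨ cong₂ _+_ (sum-map-++ (d x) xs ys) (pairSum-++ d xs ys) ⟩
    sum (map (d x) xs) + sum (map (d x) ys) + (pairSum d xs + crossSum d xs ys + pairSum d ys)
      ≡⟨ regroup (sum (map (d x) xs)) (sum (map (d x) ys)) (pairSum d xs) (crossSum d xs ys) (pairSum d ys) ⟩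
    sum (map (d x) xs) + pairSum d xs + (sum (map (d x) ys) + crossSum d xs ys) + pairSum d ys ∎
    where
      regroup : ∀ a b c e f → a + b + (c + e + f) ≡ a + c + (b + e) + f
      regroup = solve-∀

  pairSum-map : (d : B → B → ℕ) (g : A → B) (xs : List A) →
                pairSum d (map g xs) ≡ pairSum (λ u v → d (g u) (g v)) xs
  pairSum-map d g []       = refl
  pairSum-map d g (x ∷ xs) = cong₂ _+_ (sum-map-∘ (d (g x)) g xs) (pairSum-map d g xs)

  pairSum-cong : {d d′ : A → A → ℕ} → (∀ x y → d x y ≡ d′ x y) → ∀ xs → pairSum d xs ≡ pairSum d′ xs
  pairSum-cong d≗d′ []       = refl
  pairSum-cong d≗d′ (x ∷ xs) = cong₂ _+_ (sum-map-cong (d≗d′ x) xs) (pairSum-cong d≗d′ xs)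

  pairSum-cong-All : (P : A → Set) {d d′ : A → A → ℕ} → (∀ {x y} → P x → P y → d x y ≡ d′ x y) →
                     ∀ {xs} → All P xs → pairSum d xs ≡ pairSum d′ xs
  pairSum-cong-All P d≗d′ All.[]         = refl
  pairSum-cong-All P d≗d′ (px All.∷ pxs) =
    cong₂ _+_ (cong sum (map-cong-local (All.map (d≗d′ px) pxs))) (pairSum-cong-All P d≗d′ pxs)

module Ranges where

  open import Data.Nat
  open import Data.Nat.Properties
  open import Data.Nat.Tactic.RingSolver
  open import Data.Nat.ListAction using (sum)
  open import Data.List using (List; []; _∷_; _++_; [_]; map; length; applyUpTo; upTo)
  open import Data.List.Relation.Unary.All as All using (All)
  open import Data.List.Membership.Propositional using (_∈_)
  open import Data.List.Relation.Unary.Any using (here; there)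
  open import Data.Sum using (inj₁; inj₂)
  open import Data.Empty using (⊥-elim)
  open import Relation.Binary.PropositionalEquality hiding ([_])
  open ≡-Reasoning
  open Sums

  range : ℕ → ℕ → List ℕ
  range s zero    = []
  range s (suc k) = s ∷ range (suc s) k

  length-range : ∀ s k → length (range s k) ≡ k
  length-range s zero    = refl
  length-range s (suc k) = cong suc (length-range (suc s) k)

  range-++ : ∀ s m k → range s (m + k) ≡ range s m ++ range (s + m) k
  range-++ s zero    k = cong (λ t → range t k) (sym (+-identityʳ s))
  range-++ s (suc m) k =
    cong (s ∷_) (trans (range-++ (suc s) m k) (cong (λ t → range (suc s) m ++ range t k) (sym (+-suc s m))))

  range-∷ʳ : ∀ s k → range s (suc k) ≡ range s k ++ [ s + k ]
  range-∷ʳ s k = trans (cong (range s) (+-comm 1 k)) (range-++ s k 1)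

  applyUpTo-range : ∀ (f : ℕ → ℕ) s k → (∀ i → f i ≡ s + i) → applyUpTo f k ≡ range s k
  applyUpTo-range f s zero    f≗s+ = refl
  applyUpTo-range f s (suc k) f≗s+ =
    cong₂ _∷_ (trans (f≗s+ 0) (+-identityʳ s))
              (applyUpTo-range (λ i → f (suc i)) (suc s) k (λ i → trans (f≗s+ (suc i)) (+-suc s i)))

  upTo-range : ∀ k → upTo k ≡ range 0 k
  upTo-range k = applyUpTo-range (λ i → i) 0 k (λ i → refl)

  All-range : ∀ {P : ℕ → Set} s k → (∀ i → s ≤ i → i < s + k → P i) → All P (range s k)
  All-range s zero    h = All.[]
  All-range s (suc k) h =
    h s ≤-refl (m<m+n s z<s) All.∷
    All-range (suc s) k (λ i s<i i<s+k → h i (<⇒≤ s<i) (subst (i <_) (sym (+-suc s k)) i<s+k))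

  ∈-range : ∀ s k {i} → s ≤ i → i < s + k → i ∈ range s k
  ∈-range s zero    s≤i i<s+0 = ⊥-elim (<⇒≱ i<s+0 (subst (_≤ _) (sym (+-identityʳ s)) s≤i))
  ∈-range s (suc k) {i} s≤i i<s+k with m≤n⇒m<n∨m≡n s≤i
  ... | inj₂ refl = here refl
  ... | inj₁ s<i  = there (∈-range (suc s) k s<i (subst (i <_) (+-suc s k) i<s+k))

  sum-dist-range-above : ∀ c d w → 2 * sum (map (λ i → ∣ i - c ∣) (range (d + c) w)) + w ≡ w * (2 * d + w)
  sum-dist-range-above c d zero    = refl
  sum-dist-range-above c d (suc w) = begin
    2 * (∣ d + c - c ∣ + S) + suc w     ≡⟨ cong (λ t → 2 * (t + S) + suc w) ∣d+c-c∣≡d ⟩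
    2 * (d + S) + suc w                 ≡⟨ rearrange d S w ⟩
    2 * d + suc (2 * S + w)             ≡⟨ cong (λ t → 2 * d + suc t) (sum-dist-range-above c (suc d) w) ⟩
    2 * d + suc (w * (2 * suc d + w))   ≡⟨ solve (d ∷ w ∷ []) ⟩
    suc w * (2 * d + suc w)             ∎
    where
      S = sum (map (λ i → ∣ i - c ∣) (range (suc d + c) w))
      ∣d+c-c∣≡d : ∣ d + c - c ∣ ≡ d
      ∣d+c-c∣≡d = trans (cong (∣_- c ∣) (+-comm d c)) (trans (∣-∣-comm (c + d) c) (∣m-m+n∣≡n c d))
      rearrange : ∀ d S w → 2 * (d + S) + suc w ≡ 2 * d + suc (2 * S + w)
      rearrange = solve-∀

  sum-dist-range-below : ∀ c s w e → s + w + e ≡ c →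
                         2 * sum (map (λ i → ∣ i - c ∣) (range s w)) ≡ w * (2 * e + suc w)
  sum-dist-range-below c s zero    e _   = refl
  sum-dist-range-below c s (suc w) e s+w+e≡c = begin
    2 * (∣ s - c ∣ + S)                   ≡⟨ cong (λ t → 2 * (t + S)) ∣s-c∣≡w+e ⟩
    2 * (suc w + e + S)                   ≡⟨ rearrange w e S ⟩
    2 * suc w + 2 * e + 2 * S             ≡⟨ cong (2 * suc w + 2 * e +_) (sum-dist-range-below c (suc s) w e s+1+w+e≡c) ⟩
    2 * suc w + 2 * e + w * (2 * e + suc w) ≡⟨ solve (w ∷ e ∷ []) ⟩
    suc w * (2 * e + suc (suc w))         ∎
    where
      S = sum (map (λ i → ∣ i - c ∣) (range (suc s) w))
      ∣s-c∣≡w+e : ∣ s - c ∣ ≡ suc w + e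
      ∣s-c∣≡w+e = trans (cong (∣ s -_∣) (trans (sym s+w+e≡c) (+-assoc s (suc w) e))) (∣m-m+n∣≡n s (suc w + e))
      s+1+w+e≡c : suc s + w + e ≡ c
      s+1+w+e≡c = trans (cong (_+ e) (sym (+-suc s w))) s+w+e≡c
      rearrange : ∀ w e S → 2 * (suc w + e + S) ≡ 2 * suc w + 2 * e + 2 * S
      rearrange = solve-∀

  pairSum-dist-range : ∀ s w → 6 * pairSum ∣_-_∣ (range s w) + w ≡ w * w * w
  pairSum-dist-range s zero    = refl
  pairSum-dist-range s (suc w) = +-cancelʳ-≡ (3 * w) _ _ (begin
    6 * (S + P) + suc w + 3 * w        ≡⟨ rearrange S P w ⟩
    3 * (2 * S + w) + (6 * P + w) + 1   ≡⟨ cong₂ (λ x y → 3 * x + y + 1) first-row (pairSum-dist-range (suc s) w) ⟩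
    3 * (w * (2 * 1 + w)) + w * w * w + 1 ≡⟨ solve (w ∷ []) ⟩
    suc w * suc w * suc w + 3 * w       ∎)
    where
      S = sum (map (∣ s -_∣) (range (suc s) w))
      P = pairSum ∣_-_∣ (range (suc s) w)
      first-row : 2 * S + w ≡ w * (2 * 1 + w)
      first-row = trans (cong (λ t → 2 * t + w) (sum-map-cong (∣-∣-comm s) (range (suc s) w)))
                        (sum-dist-range-above s 1 w)
      rearrange : ∀ S P w → 6 * (S + P) + suc w + 3 * w ≡ 3 * (2 * S + w) + (6 * P + w) + 1
      rearrange = solve-∀

  crossSum-dist-range : ∀ t w b →
    3 * crossSum ∣_-_∣ (range (t + b) w) (range b (t + t + w)) + w ≡ w * w * w + 3 * w * t * (w + t)
  crossSum-dist-range zero w b = begin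
    3 * crossSum ∣_-_∣ (range b w) (range b w) + w
      ≡⟨ cong (λ x → 3 * x + w) (crossSum-self ∣_-_∣ ∣n-n∣≡0 ∣-∣-comm (range b w)) ⟩
    3 * (2 * pairSum ∣_-_∣ (range b w)) + w
      ≡⟨ cong (_+ w) (sym (*-assoc 3 2 (pairSum ∣_-_∣ (range b w)))) ⟩
    6 * pairSum ∣_-_∣ (range b w) + w
      ≡⟨ pairSum-dist-range b w ⟩
    w * w * w
      ≡⟨ solve (w ∷ []) ⟩
    w * w * w + 3 * w * 0 * (w + 0) ∎
  crossSum-dist-range (suc t) w b = *-cancelˡ-≡ _ _ 2 (+-cancelʳ-≡ (3 * w) _ _ (begin
    2 * (3 * crossSum ∣_-_∣ R (range b (suc t + suc t + w)) + w) + 3 * w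
      ≡⟨ cong (λ x → 2 * (3 * x + w) + 3 * w) split ⟩
    2 * (3 * (Sb + (C + Se)) + w) + 3 * w
      ≡⟨ rearrange Sb C Se w ⟩
    3 * (2 * Sb + w) + 2 * (3 * C + w) + 3 * (2 * Se)
      ≡⟨ cong₃ (λ x y z → 3 * x + 2 * y + 3 * z) left-end inner right-end ⟩
    3 * (w * (2 * suc t + w)) + 2 * (w * w * w + 3 * w * t * (w + t)) + 3 * (w * (2 * t + suc w))
      ≡⟨ solve (t ∷ w ∷ []) ⟩
    2 * (w * w * w + 3 * w * suc t * (w + suc t)) + 3 * w ∎))
    where
      R = range (suc t + b) w
      e = suc b + (t + t + w)
      Sb = sum (map (λ i → ∣ i - b ∣) R)
      Se = sum (map (λ i → ∣ i - e ∣) R)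
      C  = crossSum ∣_-_∣ R (range (suc b) (t + t + w))
      outer : range b (suc t + suc t + w) ≡ b ∷ (range (suc b) (t + t + w) ++ [ e ])
      outer = trans (cong (range b) (two-more t w)) (cong (b ∷_) (range-∷ʳ (suc b) (t + t + w)))
        where
          two-more : ∀ t w → suc t + suc t + w ≡ suc (suc (t + t + w))
          two-more = solve-∀
      split : crossSum ∣_-_∣ R (range b (suc t + suc t + w)) ≡ Sb + (C + Se)
      split = begin
        crossSum ∣_-_∣ R (range b (suc t + suc t + w))
          ≡⟨ cong (crossSum ∣_-_∣ R) outer ⟩
        crossSum ∣_-_∣ R (b ∷ (range (suc b) (t + t + w) ++ [ e ]))
          ≡⟨ crossSum-∷ʳ ∣_-_∣ R b (range (suc b) (t + t + w) ++ [ e ]) ⟩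
        Sb + crossSum ∣_-_∣ R (range (suc b) (t + t + w) ++ [ e ])
          ≡⟨ cong (Sb +_) (crossSum-++ʳ ∣_-_∣ R (range (suc b) (t + t + w)) [ e ]) ⟩
        Sb + (C + crossSum ∣_-_∣ R [ e ])
          ≡⟨ cong (λ x → Sb + (C + x)) (crossSum-[]ʳ ∣_-_∣ R e) ⟩
        Sb + (C + Se) ∎
      inner : 3 * C + w ≡ w * w * w + 3 * w * t * (w + t)
      inner = subst (λ s → 3 * crossSum ∣_-_∣ (range s w) (range (suc b) (t + t + w)) + w
                             ≡ w * w * w + 3 * w * t * (w + t))
                    (+-suc t b) (crossSum-dist-range t w (suc b))
      left-end : 2 * Sb + w ≡ w * (2 * suc t + w)
      left-end = sum-dist-range-above b (suc t) w
      right-end : 2 * Se ≡ w * (2 * t + suc w)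
      right-end = sum-dist-range-below e (suc t + b) w t (reassoc t b w)
        where
          reassoc : ∀ t b w → suc t + b + w + t ≡ suc b + (t + t + w)
          reassoc = solve-∀
      rearrange : ∀ Sb C Se w →
                  2 * (3 * (Sb + (C + Se)) + w) + 3 * w ≡ 3 * (2 * Sb + w) + 2 * (3 * C + w) + 3 * (2 * Se)
      rearrange = solve-∀

-- Written over an arbitrary (+, *, literals) to be read in ℕ, in ℤ and in Cast.Cast;
-- INLINE lets the ring solvers see the expansions.
module Polynomials {A : Set} (add mul : A → A → A) (lit : ℕ → A) where

  private
    infixl 6 _+_
    infixl 7 _*_
    _+_ _*_ : A → A → A
    _+_ = add
    _*_ = mul
    {-# INLINE _+_ #-}
    {-# INLINE _*_ #-}

  vertexPoly : A → A → A
  vertexPoly a p = lit 2 + lit 2 * p + lit 4 * a + a * p + a * a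
  {-# INLINE vertexPoly #-}

  wienerPoly : A → A → A
  wienerPoly a p =
    lit 60 + lit 200 * p + lit 180 * p * p + lit 40 * p * p * p
    + lit 418 * a + lit 840 * a * p + lit 410 * a * p * p + lit 40 * a * p * p * p
    + lit 860 * a * a + lit 1045 * a * a * p + lit 240 * a * a * p * p + lit 10 * a * a * p * p * p
    + lit 700 * a * a * a + lit 440 * a * a * a * p + lit 40 * a * a * a * p * p
    + lit 220 * a * a * a * a + lit 55 * a * a * a * a * p
    + lit 22 * a * a * a * a * a
  {-# INLINE wienerPoly #-}

module Trapezium where

  open import Data.Nat
  open import Data.Nat.Properties
  open import Data.Nat.Tactic.RingSolver
  open import Data.Nat.ListAction using (sum)
  open import Data.List using (List; []; _∷_; _++_; map; length)
  open import Data.List.Properties using (map-++; map-∘; map-id; length-++; length-map)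
  open import Data.Product using (_×_; _,_; proj₁; proj₂)
  open import Function using (_∘_)
  open import Relation.Binary.PropositionalEquality
  open ≡-Reasoning
  open Sums
  open Ranges
  open Polynomials _+_ _*_ (λ c → c) public

  manhattan : ℕ × ℕ → ℕ × ℕ → ℕ
  manhattan (i , j) (i′ , j′) = ∣ i - i′ ∣ + ∣ j - j′ ∣

  row : ℕ → List ℕ → List (ℕ × ℕ)
  row j = map (_, j)

  raise : ℕ × ℕ → ℕ × ℕ
  raise (i , j) = (i , suc j)

  -- The vertices of T(p + 2a, p), translated by a to the right.
  trapezium : ℕ → ℕ → List (ℕ × ℕ)
  trapezium zero    p = row 0 (range 0 (suc p)) ++ row 1 (range 0 (suc p))
  trapezium (suc a) p = row 0 (range (suc a) (suc p)) ++ map raise (trapezium a (2 + p))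

  heightPoly : ℕ → ℕ → ℕ
  heightPoly a p = 6 + 6 * p + 23 * a + 9 * a * p + 21 * a * a + 3 * a * a * p + 4 * a * a * a
  {-# INLINE heightPoly #-}

  spreadPoly : ℕ → ℕ → ℕ → ℕ
  spreadPoly a t v =
    8 * v + 12 * v * v + 4 * v * v * v + 12 * t + 24 * t * v + 12 * t * v * v + 12 * t * t
    + 12 * t * t * v + 10 * a + 23 * a * v + 15 * a * v * v + 2 * a * v * v * v + 24 * a * t
    + 30 * a * t * v + 6 * a * t * v * v + 6 * a * t * t + 6 * a * t * t * v + 12 * a * a
    + 15 * a * a * v + 3 * a * a * v * v + 6 * a * a * t + 6 * a * a * t * v + 2 * a * a * a
    + 2 * a * a * a * v
  {-# INLINE spreadPoly #-}

  length-row : ∀ j s k → length (row j (range s k)) ≡ k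
  length-row j s k = trans (length-map _ (range s k)) (length-range s k)

  length-trapezium : ∀ a p → length (trapezium a p) ≡ vertexPoly a p
  length-trapezium zero p = begin
    length (row 0 R ++ row 1 R)             ≡⟨ length-++ (row 0 R) ⟩
    length (row 0 R) + length (row 1 R)     ≡⟨ cong₂ _+_ (length-row 0 0 (suc p)) (length-row 1 0 (suc p)) ⟩
    suc p + suc p                           ≡⟨ solve (p ∷ []) ⟩
    vertexPoly 0 p ∎
    where R = range 0 (suc p)
  length-trapezium (suc a) p = begin
    length (row 0 (range (suc a) (suc p)) ++ map raise (trapezium a (2 + p)))
      ≡⟨ length-++ (row 0 (range (suc a) (suc p))) ⟩
    length (row 0 (range (suc a) (suc p))) + length (map raise (trapezium a (2 + p)))
      ≡⟨ cong₂ _+_ (length-row 0 (suc a) (suc p)) (length-map raise (trapezium a (2 + p))) ⟩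
    suc p + length (trapezium a (2 + p))   ≡⟨ cong (suc p +_) (length-trapezium a (2 + p)) ⟩
    suc p + vertexPoly a (2 + p)           ≡⟨ solve (a ∷ p ∷ []) ⟩
    vertexPoly (suc a) p ∎

  sum-heights-row : ∀ j xs → sum (map proj₂ (row j xs)) ≡ length xs * j
  sum-heights-row j xs = trans (sum-map-∘ proj₂ (_, j) xs) (sum-map-const j xs)

  heights-trapezium : ∀ a p → 6 * sum (map proj₂ (trapezium a p)) ≡ heightPoly a p
  heights-trapezium zero p = begin
    6 * sum (map proj₂ (row 0 R ++ row 1 R))
      ≡⟨ cong (6 *_) (sum-map-++ proj₂ (row 0 R) (row 1 R)) ⟩
    6 * (sum (map proj₂ (row 0 R)) + sum (map proj₂ (row 1 R)))
      ≡⟨ cong₂ (λ x y → 6 * (x + y)) (sum-heights-row 0 R) (sum-heights-row 1 R) ⟩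
    6 * (length R * 0 + length R * 1)
      ≡⟨ cong (λ k → 6 * (k * 0 + k * 1)) (length-range 0 (suc p)) ⟩
    6 * (suc p * 0 + suc p * 1)   ≡⟨ solve (p ∷ []) ⟩
    heightPoly 0 p ∎
    where R = range 0 (suc p)
  heights-trapezium (suc a) p = begin
    6 * sum (map proj₂ (row 0 R ++ map raise T))
      ≡⟨ cong (6 *_) (sum-map-++ proj₂ (row 0 R) (map raise T)) ⟩
    6 * (sum (map proj₂ (row 0 R)) + sum (map proj₂ (map raise T)))
      ≡⟨ cong₂ (λ x y → 6 * (x + y)) (sum-heights-row 0 R)
               (trans (sum-map-∘ proj₂ raise T) (sum-map-suc proj₂ T)) ⟩
    6 * (length R * 0 + (H + length T))
      ≡⟨ cong (λ k → 6 * (k * 0 + (H + length T))) (length-range (suc a) (suc p)) ⟩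
    6 * (suc p * 0 + (H + length T))
      ≡⟨ distrib p H (length T) ⟩
    6 * H + 6 * length T
      ≡⟨ cong₂ (λ x y → x + 6 * y) (heights-trapezium a (2 + p)) (length-trapezium a (2 + p)) ⟩
    heightPoly a (2 + p) + 6 * vertexPoly a (2 + p) ≡⟨ solve (a ∷ p ∷ []) ⟩
    heightPoly (suc a) p ∎
    where
      R = range (suc a) (suc p)
      T = trapezium a (2 + p)
      H = sum (map proj₂ T)
      distrib : ∀ p H N → 6 * (suc p * 0 + (H + N)) ≡ 6 * H + 6 * N
      distrib = solve-∀

  abscissae-row : ∀ j xs → map proj₁ (row j xs) ≡ xs
  abscissae-row j xs = trans (sym (map-∘ xs)) (map-id xs)

  abscissae-trapezium-zero : ∀ q → map proj₁ (trapezium 0 q) ≡ range 0 (suc q) ++ range 0 (suc q)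
  abscissae-trapezium-zero q =
    trans (map-++ proj₁ (row 0 R) (row 1 R)) (cong₂ _++_ (abscissae-row 0 R) (abscissae-row 1 R))
    where R = range 0 (suc q)

  abscissae-trapezium-suc : ∀ a q →
    map proj₁ (trapezium (suc a) q) ≡ range (suc a) (suc q) ++ map proj₁ (trapezium a (2 + q))
  abscissae-trapezium-suc a q =
    trans (map-++ proj₁ (row 0 R) (map raise T)) (cong₂ _++_ (abscissae-row 0 R) (sym (map-∘ T)))
    where
      R = range (suc a) (suc q)
      T = trapezium a (2 + q)

  crossSum-dist-centred : ∀ t v b →
    3 * crossSum ∣_-_∣ (range (t + b) (suc v)) (range b (suc (t + t + v))) + suc v
      ≡ suc v * suc v * suc v + 3 * suc v * t * (suc v + t)
  crossSum-dist-centred t v b =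
    subst (λ k → 3 * crossSum ∣_-_∣ (range (t + b) (suc v)) (range b k) + suc v
                   ≡ suc v * suc v * suc v + 3 * suc v * t * (suc v + t))
          (+-suc (t + t) v) (crossSum-dist-range t (suc v) b)

  spread-trapezium : ∀ a t v →
    6 * crossSum ∣_-_∣ (range (t + a) (suc v)) (map proj₁ (trapezium a (t + t + v))) ≡ spreadPoly a t v
  spread-trapezium zero t v = +-cancelʳ-≡ (4 * suc v) _ _ (begin
    6 * crossSum ∣_-_∣ R (map proj₁ (trapezium 0 (t + t + v))) + 4 * suc v
      ≡⟨ cong (λ x → 6 * x + 4 * suc v) (trans (cong (crossSum ∣_-_∣ R) (abscissae-trapezium-zero (t + t + v)))
                                                (crossSum-++ʳ ∣_-_∣ R B B)) ⟩
    6 * (F + F) + 4 * suc v         ≡⟨ rearrange F (suc v) ⟩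
    4 * (3 * F + suc v)             ≡⟨ cong (4 *_) (crossSum-dist-centred t v 0) ⟩
    4 * (suc v * suc v * suc v + 3 * suc v * t * (suc v + t)) ≡⟨ solve (t ∷ v ∷ []) ⟩
    spreadPoly 0 t v + 4 * suc v ∎)
    where
      R = range (t + 0) (suc v)
      B = range 0 (suc (t + t + v))
      F = crossSum ∣_-_∣ R B
      rearrange : ∀ F w → 6 * (F + F) + 4 * w ≡ 4 * (3 * F + w)
      rearrange = solve-∀
  spread-trapezium (suc a) t v = +-cancelʳ-≡ (2 * suc v) _ _ (begin
    6 * crossSum ∣_-_∣ R (map proj₁ (trapezium (suc a) (t + t + v))) + 2 * suc v
      ≡⟨ cong (λ x → 6 * x + 2 * suc v) split ⟩
    6 * (F + G) + 2 * suc v         ≡⟨ rearrange F G (suc v) ⟩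
    2 * (3 * F + suc v) + 6 * G     ≡⟨ cong₂ (λ x y → 2 * x + y) (crossSum-dist-centred t v (suc a)) upper ⟩
    2 * (suc v * suc v * suc v + 3 * suc v * t * (suc v + t)) + spreadPoly a (suc t) v ≡⟨ solve (a ∷ t ∷ v ∷ []) ⟩
    spreadPoly (suc a) t v + 2 * suc v ∎)
    where
      R = range (t + suc a) (suc v)
      T = trapezium a (2 + (t + t + v))
      F = crossSum ∣_-_∣ R (range (suc a) (suc (t + t + v)))
      G = crossSum ∣_-_∣ R (map proj₁ T)
      split : crossSum ∣_-_∣ R (map proj₁ (trapezium (suc a) (t + t + v))) ≡ F + G
      split = trans (cong (crossSum ∣_-_∣ R) (abscissae-trapezium-suc a (t + t + v)))
                    (crossSum-++ʳ ∣_-_∣ R (range (suc a) (suc (t + t + v))) (map proj₁ T))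
      upper : 6 * G ≡ spreadPoly a (suc t) v
      upper = subst₂ (λ s q → 6 * crossSum ∣_-_∣ (range s (suc v)) (map proj₁ (trapezium a q))
                                ≡ spreadPoly a (suc t) v)
                     (sym (+-suc t a)) (two-more t v) (spread-trapezium a (suc t) v)
        where
          two-more : ∀ t v → suc t + suc t + v ≡ 2 + (t + t + v)
          two-more = solve-∀
      rearrange : ∀ F G w → 6 * (F + G) + 2 * w ≡ 2 * (3 * F + w) + 6 * G
      rearrange = solve-∀

  pairSum-row : ∀ j xs → pairSum manhattan (row j xs) ≡ pairSum ∣_-_∣ xs
  pairSum-row j xs =
    trans (pairSum-map manhattan (_, j) xs)
          (pairSum-cong (λ x y → trans (cong (∣ x - y ∣ +_) (∣n-n∣≡0 j)) (+-identityʳ _)) xs)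

  crossSum-adjacent-rows : ∀ xs →
    crossSum manhattan (row 0 xs) (row 1 xs) ≡ 2 * pairSum ∣_-_∣ xs + length xs * length xs
  crossSum-adjacent-rows xs = begin
    crossSum manhattan (row 0 xs) (row 1 xs)     ≡⟨ crossSum-map manhattan (_, 0) (_, 1) xs xs ⟩
    crossSum (λ x y → ∣ x - y ∣ + 1) xs xs       ≡⟨ crossSum-+ ∣_-_∣ (λ _ _ → 1) xs xs ⟩
    crossSum ∣_-_∣ xs xs + crossSum (λ _ _ → 1) xs xs
      ≡⟨ cong₂ _+_ (crossSum-self ∣_-_∣ ∣n-n∣≡0 ∣-∣-comm xs)
                   (trans (crossSum-constʳ (λ _ → 1) xs xs)
                          (cong (length xs *_) (trans (sum-map-const 1 xs) (*-identityʳ _)))) ⟩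
    2 * pairSum ∣_-_∣ xs + length xs * length xs ∎

  crossSum-row-raise : ∀ xs T →
    crossSum manhattan (row 0 xs) (map raise T)
      ≡ crossSum ∣_-_∣ xs (map proj₁ T) + length xs * (sum (map proj₂ T) + length T)
  crossSum-row-raise xs T = begin
    crossSum manhattan (row 0 xs) (map raise T)
      ≡⟨ crossSum-map manhattan (_, 0) raise xs T ⟩
    crossSum (λ x u → ∣ x - proj₁ u ∣ + suc (proj₂ u)) xs T
      ≡⟨ crossSum-+ (λ x u → ∣ x - proj₁ u ∣) (λ _ u → suc (proj₂ u)) xs T ⟩
    crossSum (λ x u → ∣ x - proj₁ u ∣) xs T + crossSum (λ _ u → suc (proj₂ u)) xs T
      ≡⟨ cong₂ _+_ (sym (crossSum-mapʳ ∣_-_∣ proj₁ xs T))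
                   (trans (crossSum-constʳ (suc ∘ proj₂) xs T) (cong (length xs *_) (sum-map-suc proj₂ T))) ⟩
    crossSum ∣_-_∣ xs (map proj₁ T) + length xs * (sum (map proj₂ T) + length T) ∎

  pairSum-trapezium-zero : ∀ p →
    pairSum manhattan (trapezium 0 p)
      ≡ pairSum ∣_-_∣ (range 0 (suc p)) + (2 * pairSum ∣_-_∣ (range 0 (suc p)) + suc p * suc p)
        + pairSum ∣_-_∣ (range 0 (suc p))
  pairSum-trapezium-zero p = begin
    pairSum manhattan (row 0 R ++ row 1 R)
      ≡⟨ pairSum-++ manhattan (row 0 R) (row 1 R) ⟩
    pairSum manhattan (row 0 R) + crossSum manhattan (row 0 R) (row 1 R) + pairSum manhattan (row 1 R)
      ≡⟨ cong₃ (λ x y z → x + y + z) (pairSum-row 0 R) (crossSum-adjacent-rows R) (pairSum-row 1 R) ⟩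
    P + (2 * P + length R * length R) + P
      ≡⟨ cong (λ k → P + (2 * P + k * k) + P) (length-range 0 (suc p)) ⟩
    P + (2 * P + suc p * suc p) + P ∎
    where
      R = range 0 (suc p)
      P = pairSum ∣_-_∣ R

  pairSum-trapezium-suc : ∀ a p →
    pairSum manhattan (trapezium (suc a) p)
      ≡ pairSum ∣_-_∣ (range (suc a) (suc p))
        + (crossSum ∣_-_∣ (range (suc a) (suc p)) (map proj₁ (trapezium a (2 + p)))
           + suc p * (sum (map proj₂ (trapezium a (2 + p))) + length (trapezium a (2 + p))))
        + pairSum manhattan (trapezium a (2 + p))
  pairSum-trapezium-suc a p = begin
    pairSum manhattan (row 0 R ++ map raise T)
      ≡⟨ pairSum-++ manhattan (row 0 R) (map raise T) ⟩
    pairSum manhattan (row 0 R) + crossSum manhattan (row 0 R) (map raise T) + pairSum manhattan (map raise T)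
      ≡⟨ cong₃ (λ x y z → x + y + z) (pairSum-row 0 R) (crossSum-row-raise R T) (pairSum-map manhattan raise T) ⟩
    P + (G + length R * (H + N)) + W
      ≡⟨ cong (λ k → P + (G + k * (H + N)) + W) (length-range (suc a) (suc p)) ⟩
    P + (G + suc p * (H + N)) + W ∎
    where
      R = range (suc a) (suc p)
      T = trapezium a (2 + p)
      P = pairSum ∣_-_∣ R
      G = crossSum ∣_-_∣ R (map proj₁ T)
      H = sum (map proj₂ T)
      N = length T
      W = pairSum manhattan T

  wiener-trapezium : ∀ a p → 60 * pairSum manhattan (trapezium a p) ≡ wienerPoly a p
  wiener-trapezium zero p = +-cancelʳ-≡ (40 * suc p) _ _ (begin
    60 * pairSum manhattan (trapezium 0 p) + 40 * suc p
      ≡⟨ cong (λ x → 60 * x + 40 * suc p) (pairSum-trapezium-zero p) ⟩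
    60 * (P + (2 * P + suc p * suc p) + P) + 40 * suc p
      ≡⟨ rearrange P (suc p) ⟩
    40 * (6 * P + suc p) + 60 * (suc p * suc p)
      ≡⟨ cong (λ x → 40 * x + 60 * (suc p * suc p)) (pairSum-dist-range 0 (suc p)) ⟩
    40 * (suc p * suc p * suc p) + 60 * (suc p * suc p)
      ≡⟨ solve (p ∷ []) ⟩
    wienerPoly 0 p + 40 * suc p ∎)
    where
      P = pairSum ∣_-_∣ (range 0 (suc p))
      rearrange : ∀ P w → 60 * (P + (2 * P + w * w) + P) + 40 * w ≡ 40 * (6 * P + w) + 60 * (w * w)
      rearrange = solve-∀
  wiener-trapezium (suc a) p = +-cancelʳ-≡ (10 * suc p) _ _ (begin
    60 * pairSum manhattan (trapezium (suc a) p) + 10 * suc p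
      ≡⟨ cong (λ x → 60 * x + 10 * suc p) (pairSum-trapezium-suc a p) ⟩
    60 * (P + (G + suc p * (H + N)) + W) + 10 * suc p
      ≡⟨ rearrange P G (suc p) H N W ⟩
    10 * (6 * P + suc p) + 10 * (6 * G) + 10 * suc p * (6 * H) + 60 * suc p * N + 60 * W
      ≡⟨ cong₂ (λ x y → 10 * x + 10 * y + 10 * suc p * (6 * H) + 60 * suc p * N + 60 * W)
               (pairSum-dist-range (suc a) (suc p)) (spread-trapezium a 1 p) ⟩
    10 * (suc p * suc p * suc p) + 10 * spreadPoly a 1 p + 10 * suc p * (6 * H) + 60 * suc p * N + 60 * W
      ≡⟨ cong₃ (λ x y z → 10 * (suc p * suc p * suc p) + 10 * spreadPoly a 1 p + 10 * suc p * x + 60 * suc p * y + z)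
               (heights-trapezium a (2 + p)) (length-trapezium a (2 + p)) (wiener-trapezium a (2 + p)) ⟩
    10 * (suc p * suc p * suc p) + 10 * spreadPoly a 1 p + 10 * suc p * heightPoly a (2 + p)
      + 60 * suc p * vertexPoly a (2 + p) + wienerPoly a (2 + p)
      ≡⟨ solve (a ∷ p ∷ []) ⟩
    wienerPoly (suc a) p + 10 * suc p ∎)
    where
      R = range (suc a) (suc p)
      T = trapezium a (2 + p)
      P = pairSum ∣_-_∣ R
      G = crossSum ∣_-_∣ R (map proj₁ T)
      H = sum (map proj₂ T)
      N = length T
      W = pairSum manhattan T
      rearrange : ∀ P G w H N W →
        60 * (P + (G + w * (H + N)) + W) + 10 * w
          ≡ 10 * (6 * P + w) + 10 * (6 * G) + 10 * w * (6 * H) + 60 * w * N + 60 * W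
      rearrange = solve-∀

module Grid where

  open import Data.Nat
  open import Data.Nat.Properties
  open import Data.Nat.Tactic.RingSolver
  open import Data.List using (List; []; _∷_; _++_; map; concatMap; filter)
  open import Data.List.Properties using (filter-++; filter-all; filter-none; filter-≐; ++-identityʳ; map-∘; map-++)
  open import Data.List.Relation.Unary.All as All using (All)
  open import Data.List.Relation.Unary.All.Properties using (map⁺; ++⁺; all-filter)
  open import Data.List.Membership.Propositional using (_∈_)
  open import Data.List.Membership.Propositional.Properties using (∈-map⁺; ∈-++⁺ˡ; ∈-++⁺ʳ)
  open import Data.Product using (_×_; _,_; proj₁; proj₂)
  open import Relation.Nullary using (does; yes; no)
  open import Data.Sum using (_⊎_; inj₁; inj₂)
  open import Relation.Nullary.Decidable using (_×-dec_)
  open import Relation.Unary using (Pred; Decidable; ∁)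
  open import Level using (0ℓ)
  open import Data.Bool using (true; false)
  open import Relation.Binary.PropositionalEquality
  open ≡-Reasoning
  open Ranges
  open Trapezium

  private variable
    A B : Set

  filter-map : {P : Pred B 0ℓ} (P? : Decidable P) (g : A → B) (xs : List A) →
               filter P? (map g xs) ≡ map g (filter (λ x → P? (g x)) xs)
  filter-map P? g []       = refl
  filter-map P? g (x ∷ xs) with does (P? (g x))
  ... | true  = cong (g x ∷_) (filter-map P? g xs)
  ... | false = filter-map P? g xs

  filter-range : {P : Pred ℕ 0ℓ} (P? : Decidable P) (s k r : ℕ) →
                 (∀ {i} → P i → s ≤ i × i < s + k) → (∀ {i} → s ≤ i → i < s + k → P i) →
                 filter P? (range 0 (s + k + r)) ≡ range s k
  filter-range {P} P? s k r P⇒ ⇒P = begin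
    filter P? (range 0 (s + k + r))
      ≡⟨ cong (λ m → filter P? (range 0 m)) (+-assoc s k r) ⟩
    filter P? (range 0 (s + (k + r)))
      ≡⟨ cong (filter P?) (range-++ 0 s (k + r)) ⟩
    filter P? (range 0 s ++ range s (k + r))
      ≡⟨ cong (λ xs → filter P? (range 0 s ++ xs)) (range-++ s k r) ⟩
    filter P? (range 0 s ++ (range s k ++ range (s + k) r))
      ≡⟨ filter-++ P? (range 0 s) _ ⟩
    filter P? (range 0 s) ++ filter P? (range s k ++ range (s + k) r)
      ≡⟨ cong (filter P? (range 0 s) ++_) (filter-++ P? (range s k) _) ⟩
    filter P? (range 0 s) ++ (filter P? (range s k) ++ filter P? (range (s + k) r))
      ≡⟨ cong₃ (λ xs ys zs → xs ++ (ys ++ zs)) (filter-none P? left) (filter-all P? middle) (filter-none P? right) ⟩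
    range s k ++ []                                          ≡⟨ ++-identityʳ (range s k) ⟩
    range s k ∎
    where
      left : All (∁ P) (range 0 s)
      left = All-range 0 s (λ i _ i<s Pi → <⇒≱ i<s (proj₁ (P⇒ Pi)))
      middle : All P (range s k)
      middle = All-range s k (λ i s≤i i<s+k → ⇒P s≤i i<s+k)
      right : All (∁ P) (range (s + k) r)
      right = All-range (s + k) r (λ i s+k≤i _ Pi → <⇒≱ (proj₂ (P⇒ Pi)) s+k≤i)

  grid : ℕ → ℕ → List (ℕ × ℕ)
  grid m k = concatMap (λ j → row j (range 0 (suc m))) (range 0 k)

  Inside : ℕ → ℕ → Pred (ℕ × ℕ) 0ℓ
  Inside a p (i , j) = j ≤ suc a × a ≤ i + j × i ≤ a + p + j × i ≤ a + a + p

  inside? : ∀ a p → Decidable (Inside a p)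
  inside? a p (i , j) = j ≤? suc a ×-dec a ≤? i + j ×-dec i ≤? a + p + j ×-dec i ≤? a + a + p

  Inside-up : ∀ {a p i j j′} → Inside a p (i , j) → j ≤ j′ → j′ ≤ suc a → Inside a p (i , j′)
  Inside-up {a} {p} {i} (_ , left , right , side) j≤j′ j′≤a+1 =
    j′≤a+1 , ≤-trans left (+-monoʳ-≤ i j≤j′) , ≤-trans right (+-monoʳ-≤ (a + p) j≤j′) , side

  Inside-between : ∀ {a p x y z j} → Inside a p (x , j) → Inside a p (z , j) → x ≤ y → y ≤ z →
                   Inside a p (y , j)
  Inside-between {j = j} (j≤ , left , _ , _) (_ , _ , right , side) x≤y y≤z =
    j≤ , ≤-trans left (+-monoˡ-≤ j x≤y) , ≤-trans y≤z right , ≤-trans y≤z side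

  Inside-raise⁺ : ∀ {a p u} → Inside a (2 + p) u → Inside (suc a) p (raise u)
  Inside-raise⁺ {a} {p} {i , j} (j≤ , left , right , side) =
    s≤s j≤ , subst (suc a ≤_) (sym (+-suc i j)) (s≤s left) ,
    subst (i ≤_) (shift-right a p j) right , subst (i ≤_) (shift-side a p) side
    where
      shift-right : ∀ a p j → a + (2 + p) + j ≡ suc a + p + suc j
      shift-right = solve-∀
      shift-side : ∀ a p → a + a + (2 + p) ≡ suc a + suc a + p
      shift-side = solve-∀

  Inside-raise⁻ : ∀ {a p u} → Inside (suc a) p (raise u) → Inside a (2 + p) u
  Inside-raise⁻ {a} {p} {i , j} (j≤ , left , right , side) =
    ≤-pred j≤ , ≤-pred (subst (suc a ≤_) (+-suc i j) left) ,
    subst (i ≤_) (shift-right a p j) right , subst (i ≤_) (shift-side a p) side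
    where
      shift-right : ∀ a p j → suc a + p + suc j ≡ a + (2 + p) + j
      shift-right = solve-∀
      shift-side : ∀ a p → suc a + suc a + p ≡ a + a + (2 + p)
      shift-side = solve-∀

  grid-suc : ∀ m k → grid m (suc k) ≡ row 0 (range 0 (suc m)) ++ map raise (grid m k)
  grid-suc m k = cong (row 0 (range 0 (suc m)) ++_) (sym (raise-rows 0 k))
    where
      raise-rows : ∀ s k → map raise (concatMap (λ j → row j (range 0 (suc m))) (range s k))
                           ≡ concatMap (λ j → row j (range 0 (suc m))) (range (suc s) k)
      raise-rows s zero    = refl
      raise-rows s (suc k) =
        trans (map-++ raise (row s (range 0 (suc m))) _)
              (cong₂ _++_ (sym (map-∘ (range 0 (suc m)))) (raise-rows (suc s) k))

  filter-bottom-row : ∀ a p →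
    filter (λ i → inside? (suc a) p (i , 0)) (range 0 (suc (p + suc a + suc a))) ≡ range (suc a) (suc p)
  filter-bottom-row a p =
    trans (cong (λ m → filter (λ i → inside? (suc a) p (i , 0)) (range 0 m)) (split a p))
          (filter-range (λ i → inside? (suc a) p (i , 0)) (suc a) (suc p) (suc a) in-row⁻ in-row⁺)
    where
      split : ∀ a p → suc (p + suc a + suc a) ≡ suc a + suc p + suc a
      split = solve-∀
      in-row⁻ : ∀ {i} → Inside (suc a) p (i , 0) → suc a ≤ i × i < suc a + suc p
      in-row⁻ {i} (_ , left , right , _) =
        subst (suc a ≤_) (+-identityʳ i) left ,
        subst (suc i ≤_) (trans (cong suc (+-identityʳ (suc a + p))) (sym (+-suc (suc a) p))) (s≤s right)
      in-row⁺ : ∀ {i} → suc a ≤ i → i < suc a + suc p → Inside (suc a) p (i , 0)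
      in-row⁺ {i} a<i i<a+p = z≤n , subst (suc a ≤_) (sym (+-identityʳ i)) a<i , right , ≤-trans right side
        where
          side : suc a + p + 0 ≤ suc a + suc a + p
          side = subst₂ _≤_ (sym (+-identityʳ _)) (sym (+-assoc (suc a) (suc a) p)) (m≤n+m (suc a + p) (suc a))
          right : i ≤ suc a + p + 0
          right = ≤-pred (subst (suc i ≤_) (trans (+-suc (suc a) p) (cong suc (sym (+-identityʳ (suc a + p))))) i<a+p)

  filter-inside-grid : ∀ a p → filter (inside? a p) (grid (p + a + a) (2 + a)) ≡ trapezium a p
  filter-inside-grid zero p = begin
    filter (inside? 0 p) (grid (p + 0 + 0) 2)
      ≡⟨ cong (λ m → filter (inside? 0 p) (grid m 2)) (trans (+-identityʳ (p + 0)) (+-identityʳ p)) ⟩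
    filter (inside? 0 p) (row 0 R ++ (row 1 R ++ []))
      ≡⟨ cong (λ xs → filter (inside? 0 p) (row 0 R ++ xs)) (++-identityʳ (row 1 R)) ⟩
    filter (inside? 0 p) (row 0 R ++ row 1 R)
      ≡⟨ filter-all (inside? 0 p) (++⁺ (map⁺ (All-range 0 (suc p) bottom)) (map⁺ (All-range 0 (suc p) top))) ⟩
    row 0 R ++ row 1 R ∎
    where
      R = range 0 (suc p)
      bottom : ∀ i → 0 ≤ i → i < suc p → Inside 0 p (i , 0)
      bottom i _ (s≤s i≤p) = z≤n , z≤n , subst (i ≤_) (sym (+-identityʳ p)) i≤p , i≤p
      top : ∀ i → 0 ≤ i → i < suc p → Inside 0 p (i , 1)
      top i _ (s≤s i≤p) = ≤-refl , z≤n , ≤-trans i≤p (m≤m+n p 1) , i≤p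
  filter-inside-grid (suc a) p = begin
    filter (inside? (suc a) p) (grid n (2 + suc a))
      ≡⟨ cong (filter (inside? (suc a) p)) (grid-suc n (2 + a)) ⟩
    filter (inside? (suc a) p) (row 0 (range 0 (suc n)) ++ map raise (grid n (2 + a)))
      ≡⟨ filter-++ (inside? (suc a) p) (row 0 (range 0 (suc n))) _ ⟩
    filter (inside? (suc a) p) (row 0 (range 0 (suc n))) ++ filter (inside? (suc a) p) (map raise (grid n (2 + a)))
      ≡⟨ cong₂ _++_ (filter-map (inside? (suc a) p) (_, 0) (range 0 (suc n)))
                    (filter-map (inside? (suc a) p) raise (grid n (2 + a))) ⟩
    row 0 (filter (λ i → inside? (suc a) p (i , 0)) (range 0 (suc n)))
      ++ map raise (filter (λ u → inside? (suc a) p (raise u)) (grid n (2 + a)))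
      ≡⟨ cong₂ (λ xs ys → row 0 xs ++ map raise ys) (filter-bottom-row a p)
               (filter-≐ (λ u → inside? (suc a) p (raise u)) (inside? a (2 + p))
                         (Inside-raise⁻ , Inside-raise⁺) (grid n (2 + a))) ⟩
    row 0 (range (suc a) (suc p)) ++ map raise (filter (inside? a (2 + p)) (grid n (2 + a)))
      ≡⟨ cong (λ m → row 0 (range (suc a) (suc p)) ++ map raise (filter (inside? a (2 + p)) (grid m (2 + a))))
              (same-width a p) ⟩
    row 0 (range (suc a) (suc p)) ++ map raise (filter (inside? a (2 + p)) (grid (2 + p + a + a) (2 + a)))
      ≡⟨ cong (λ xs → row 0 (range (suc a) (suc p)) ++ map raise xs) (filter-inside-grid a (2 + p)) ⟩
    trapezium (suc a) p ∎
    where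
      n = p + suc a + suc a
      same-width : ∀ a p → p + suc a + suc a ≡ 2 + p + a + a
      same-width = solve-∀

  All-Inside-trapezium : ∀ a p → All (Inside a p) (trapezium a p)
  All-Inside-trapezium a p =
    subst (All (Inside a p)) (filter-inside-grid a p) (all-filter (inside? a p) (grid (p + a + a) (2 + a)))

  ∈-grid : ∀ m k {i j} → i ≤ m → j < k → (i , j) ∈ grid m k
  ∈-grid m (suc k) {i} {zero}  i≤m _ =
    ∈-++⁺ˡ (∈-map⁺ (_, 0) (∈-range 0 (suc m) z≤n (s≤s i≤m)))
  ∈-grid m (suc k) {i} {suc j} i≤m (s≤s j<k) =
    subst ((i , suc j) ∈_) (sym (grid-suc m k))
          (∈-++⁺ʳ (row 0 (range 0 (suc m))) (∈-map⁺ raise (∈-grid m k i≤m j<k)))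

  CornerOfRow : ℕ → ℕ → ℕ → ℕ → Set
  CornerOfRow a p r i = r ≤ a × a ≤ i + r × i ≤ a + p + r

  private
    +-swap : ∀ a p → a + p + a ≡ a + a + p
    +-swap = solve-∀

  CornerOfRow⇒Inside : ∀ {a p r i} → CornerOfRow a p r i → Inside a p (i , r)
  CornerOfRow⇒Inside {a} {p} (r≤a , left , right) = m≤n⇒m≤1+n r≤a , left , right , below-side r≤a right
    where
      below-side : ∀ {r i} → r ≤ a → i ≤ a + p + r → i ≤ a + a + p
      below-side {r} r≤a i≤ = ≤-trans i≤ (≤-trans (+-monoʳ-≤ (a + p) r≤a) (≤-reflexive (+-swap a p)))

  CornerOfRow⇒Inside-above : ∀ {a p r i} → CornerOfRow a p r i → Inside a p (i , suc r)
  CornerOfRow⇒Inside-above {a} {p} {r} {i} on@(r≤a , left , right) =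
    s≤s r≤a , ≤-trans left (+-monoʳ-≤ i (n≤1+n r)) , ≤-trans right (+-monoʳ-≤ (a + p) (n≤1+n r)) ,
    proj₂ (proj₂ (proj₂ (CornerOfRow⇒Inside on)))

  Inside⇒CornerOfRow-bottom : ∀ {a p i} → Inside a p (i , 0) → CornerOfRow a p 0 i
  Inside⇒CornerOfRow-bottom (_ , left , right , _) = z≤n , left , right

  Inside⇒CornerOfRow : ∀ {a p r i} → Inside a p (i , suc r) → CornerOfRow a p (suc r) i ⊎ CornerOfRow a p r i
  Inside⇒CornerOfRow {a} {p} {r} {i} (r<a+1 , left , right , side) with suc r ≤? a
  ... | yes r<a = inj₁ (r<a , left , right)
  ... | no  r≮a = inj₂ (≤-pred r<a+1 , ≤-trans (m≤n+m a i) (≤-reflexive (cong (i +_) (sym r≡a))) ,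
                        ≤-trans side (≤-reflexive (trans (sym (+-swap a p)) (cong (a + p +_) (sym r≡a)))))
    where
      r≡a : r ≡ a
      r≡a = ≤-antisym (≤-pred r<a+1) (≮⇒≥ r≮a)

module NaturalDifferences where

  open import Data.Nat as ℕ using (ℕ)
  open import Data.Integer as ℤ using (+_; -_; _+_; _-_; +≤+)
  import Data.Nat.Properties as ℕ
  import Data.Integer.Properties as ℤ
  open import Data.Integer.Properties using (+-monoˡ-≤; drop‿+≤+)
  open import Data.Integer.Tactic.RingSolver using (solve-∀)
  open import Data.Sum using (inj₁; inj₂)
  open import Function.Bundles using (_⇔_; mk⇔)
  open import Relation.Binary.PropositionalEquality

  -≤-⇔ : ∀ m n m′ n′ → (+ m - + n ℤ.≤ + m′ - + n′) ⇔ (m ℕ.+ n′ ℕ.≤ m′ ℕ.+ n)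
  -≤-⇔ m n m′ n′ = mk⇔ to from
    where
      cancel : ∀ x y z → x - y + (y + z) ≡ x + z
      cancel = solve-∀
      cancel′ : ∀ x y z → x - z + (y + z) ≡ x + y
      cancel′ = solve-∀
      restore : ∀ x k → x + k + - k ≡ x
      restore = solve-∀
      to : + m - + n ℤ.≤ + m′ - + n′ → m ℕ.+ n′ ℕ.≤ m′ ℕ.+ n
      to le = drop‿+≤+ (subst₂ ℤ._≤_ (cancel (+ m) (+ n) (+ n′)) (cancel′ (+ m′) (+ n) (+ n′))
                                     (+-monoˡ-≤ (+ n + + n′) le))
      from : m ℕ.+ n′ ℕ.≤ m′ ℕ.+ n → + m - + n ℤ.≤ + m′ - + n′
      from le = subst₂ ℤ._≤_ (restore (+ m - + n) (+ n + + n′)) (restore (+ m′ - + n′) (+ n + + n′))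
                  (+-monoˡ-≤ (- (+ n + + n′))
                    (subst₂ ℤ._≤_ (sym (cancel (+ m) (+ n) (+ n′))) (sym (cancel′ (+ m′) (+ n) (+ n′)))
                            (+≤+ le)))

  private
    ≤-case : ∀ {m n} → m ℕ.≤ n → ℤ.∣ + m - + n ∣ ≡ ℕ.∣ m - n ∣
    ≤-case {m} {n} m≤n =
      trans (cong ℤ.∣_∣ (ℤ.m-n≡m⊖n m n)) (trans (ℤ.∣⊖∣-≤ m≤n) (sym (ℕ.m≤n⇒∣m-n∣≡n∸m m≤n)))

  ∣+m-+n∣ : ∀ m n → ℤ.∣ + m - + n ∣ ≡ ℕ.∣ m - n ∣
  ∣+m-+n∣ m n with ℕ.≤-total m n
  ... | inj₁ m≤n = ≤-case m≤n
  ... | inj₂ n≤m = trans (ℤ.∣i-j∣≡∣j-i∣ (+ m) (+ n)) (trans (≤-case n≤m) (ℕ.∣-∣-comm n m))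

module Vertices (a p : ℕ) (1≤p : 1 ≤ p) where

  open import Defs hiding (pairSum)
  open import Data.Nat as ℕ using (ℕ; zero; suc; _≤_; _<_; z≤n; s≤s)
  import Data.Nat.Properties as ℕ
  open import Data.Nat.DivMod using (m*n/n≡m)
  open import Data.Nat.Tactic.RingSolver as ℕ-Solver using ()
  open import Data.Integer as ℤ using (ℤ; +_; -_; _-_)
  open import Data.Integer.Properties as ℤ using ()
  open import Data.Integer.Tactic.RingSolver as ℤ-Solver using ()
  open import Data.Bool using (Bool; T; _∨_)
  open import Data.Bool.Properties using (T-∧; T-∨; ∨-assoc; T?)
  open import Data.List using (map; filter; concatMap; upTo)
  open import Data.List.Properties using (map-∘; map-concatMap; concatMap-cong; filter-≐)
  open import Data.List.Membership.Propositional using (_∈_)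
  open import Data.List.Membership.Propositional.Properties using (∈-map⁺; ∈-filter⁺)
  open import Data.Product using (_×_; _,_)
  open import Data.Sum as Sum using (inj₁; inj₂)
  open import Function.Bundles using (Equivalence)
  open import Relation.Nullary using (yes; no)
  open import Relation.Nullary.Decidable using (toWitness; fromWitness)
  open import Relation.Binary.PropositionalEquality
  open Equivalence using (to; from)
  open Ranges
  open Trapezium
  open Grid
  open NaturalDifferences

  n : ℕ
  n = p ℕ.+ a ℕ.+ a

  aOf-n : aOf n p ≡ a
  aOf-n = begin
    (p ℕ.+ a ℕ.+ a ℕ.∸ p) ℕ./ 2  ≡⟨ cong (λ m → (m ℕ.∸ p) ℕ./ 2) (ℕ.+-assoc p a a) ⟩
    (p ℕ.+ (a ℕ.+ a) ℕ.∸ p) ℕ./ 2 ≡⟨ cong (ℕ._/ 2) (ℕ.m+n∸m≡n p (a ℕ.+ a)) ⟩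
    (a ℕ.+ a) ℕ./ 2              ≡⟨ cong (ℕ._/ 2) (double a) ⟩
    a ℕ.* 2 ℕ./ 2                ≡⟨ m*n/n≡m a 2 ⟩
    a ∎
    where
      open ≡-Reasoning
      double : ∀ a → a ℕ.+ a ≡ a ℕ.* 2
      double = ℕ-Solver.solve-∀

  column : ℕ → ℤ
  column i = - (+ a) ℤ.+ + i

  emb : ℕ × ℕ → Point
  emb (i , j) = (column i , + j)

  column≡ : ∀ i → column i ≡ + i - + a
  column≡ i = swap (+ a) (+ i)
    where
      swap : ∀ x y → - x ℤ.+ y ≡ y - x
      swap = ℤ-Solver.solve-∀

  column-1≡ : ∀ i → column i - + 1 ≡ + i - + suc a
  column-1≡ i = swap (+ a) (+ i)
    where
      swap : ∀ x y → - x ℤ.+ y - + 1 ≡ y - (+ 1 ℤ.+ x)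
      swap = ℤ-Solver.solve-∀

  -- The separately defined right end of the top row agrees with the slanted one since n = p + 2a.
  Rb-n : ∀ r → Rb n p r ≡ + p - + 1 ℤ.+ r
  Rb-n r with r ℤ.≟ + aOf n p
  ... | no _ = refl
  ... | yes r≡a = begin
    - (+ aOf n p) ℤ.+ + n - + 1  ≡⟨ cong (λ k → - (+ k) ℤ.+ + n - + 1) aOf-n ⟩
    - (+ a) ℤ.+ + n - + 1        ≡⟨ top-row (+ a) (+ p) ⟩
    + p - + 1 ℤ.+ + a            ≡⟨ cong (λ k → + p - + 1 ℤ.+ k) (sym (trans r≡a (cong +_ aOf-n))) ⟩
    + p - + 1 ℤ.+ r ∎
    where
      open ≡-Reasoning
      top-row : ∀ x y → - x ℤ.+ (y ℤ.+ x ℤ.+ x) - + 1 ≡ y - + 1 ℤ.+ x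
      top-row = ℤ-Solver.solve-∀

  private
    isCell⁻ : ∀ x r → T (isCell n p x r) → r ℤ.≤ + a × - r ℤ.≤ x × x ℤ.≤ Rb n p r
    isCell⁻ x r cell =
      let _ , cell′   = to (T-∧ {+ 0 ≤ᵇ r}) cell
          r≤a , cell″ = to (T-∧ {r ≤ᵇ + aOf n p}) cell′
          left , right = to (T-∧ { - r ≤ᵇ x} {x ≤ᵇ Rb n p r}) cell″
      in subst (λ k → r ℤ.≤ + k) aOf-n (toWitness r≤a) , toWitness left , toWitness right

    isCell⁺ : ∀ x r → + 0 ℤ.≤ r → r ℤ.≤ + a → - r ℤ.≤ x → x ℤ.≤ Rb n p r → T (isCell n p x r)
    isCell⁺ x r 0≤r r≤a left right =
      from (T-∧ {+ 0 ≤ᵇ r}) (fromWitness 0≤r ,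
        from (T-∧ {r ≤ᵇ + aOf n p}) (fromWitness (subst (λ k → r ℤ.≤ + k) (sym aOf-n) r≤a) ,
          from (T-∧ { - r ≤ᵇ x} {x ≤ᵇ Rb n p r}) (fromWitness left , fromWitness right)))

    -r≡0-r : ∀ r → - (+ r) ≡ + 0 - + r
    -r≡0-r r = solve (+ r)
      where
        solve : ∀ x → - x ≡ + 0 - x
        solve = ℤ-Solver.solve-∀

    Rb≡ : ∀ r → Rb n p (+ r) ≡ + (p ℕ.+ r) - + 1
    Rb≡ r = trans (Rb-n (+ r)) (solve (+ p) (+ r))
      where
        solve : ∀ x y → x - + 1 ℤ.+ y ≡ x ℤ.+ y - + 1
        solve = ℤ-Solver.solve-∀

    rotate : ∀ b r → p ℕ.+ r ℕ.+ b ≡ b ℕ.+ p ℕ.+ r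
    rotate b r = solve p r b
      where
        solve : ∀ p r b → p ℕ.+ r ℕ.+ b ≡ b ℕ.+ p ℕ.+ r
        solve = ℕ-Solver.solve-∀

  isCell⇒ : ∀ c b r → T (isCell n p (+ c - + b) (+ r)) → r ≤ a × b ≤ c ℕ.+ r × c < b ℕ.+ p ℕ.+ r
  isCell⇒ c b r cell =
    let r≤a , left , right = isCell⁻ (+ c - + b) (+ r) cell
    in ℤ.drop‿+≤+ r≤a ,
       to (-≤-⇔ 0 r c b) (subst (ℤ._≤ + c - + b) (-r≡0-r r) left) ,
       subst₂ ℕ._≤_ (ℕ.+-comm c 1) (rotate b r)
              (to (-≤-⇔ c b (p ℕ.+ r) 1) (subst (+ c - + b ℤ.≤_) (Rb≡ r) right))

  isCell⇐ : ∀ c b r → r ≤ a → b ≤ c ℕ.+ r → c < b ℕ.+ p ℕ.+ r → T (isCell n p (+ c - + b) (+ r))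
  isCell⇐ c b r r≤a left right =
    isCell⁺ (+ c - + b) (+ r) (ℤ.+≤+ z≤n) (ℤ.+≤+ r≤a)
            (subst (ℤ._≤ + c - + b) (sym (-r≡0-r r)) (from (-≤-⇔ 0 r c b) left))
            (subst (+ c - + b ℤ.≤_) (sym (Rb≡ r))
                   (from (-≤-⇔ c b (p ℕ.+ r) 1) (subst₂ ℕ._≤_ (ℕ.+-comm 1 c) (sym (rotate b r)) right)))

  isCell-column⇒ : ∀ i r → T (isCell n p (column i) (+ r)) → CornerOfRow a p r i
  isCell-column⇒ i r cell =
    let r≤a , left , right = isCell⇒ i a r (subst (λ x → T (isCell n p x (+ r))) (column≡ i) cell)
    in r≤a , left , ℕ.<⇒≤ right

  isCell-column⇐ : ∀ i r → r ≤ a → a ≤ i ℕ.+ r → i < a ℕ.+ p ℕ.+ r → T (isCell n p (column i) (+ r))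
  isCell-column⇐ i r r≤a left right =
    subst (λ x → T (isCell n p x (+ r))) (sym (column≡ i)) (isCell⇐ i a r r≤a left right)

  isCell-column-1⇒ : ∀ i r → T (isCell n p (column i - + 1) (+ r)) → CornerOfRow a p r i
  isCell-column-1⇒ i r cell =
    let r≤a , left , right = isCell⇒ i (suc a) r (subst (λ x → T (isCell n p x (+ r))) (column-1≡ i) cell)
    in r≤a , ℕ.<⇒≤ left , ℕ.≤-pred right

  isCell-column-1⇐ : ∀ i r → r ≤ a → a < i ℕ.+ r → i ≤ a ℕ.+ p ℕ.+ r →
                     T (isCell n p (column i - + 1) (+ r))
  isCell-column-1⇐ i r r≤a left right =
    subst (λ x → T (isCell n p x (+ r))) (sym (column-1≡ i)) (isCell⇐ i (suc a) r r≤a left (s≤s right))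

  cornerOfRow : ℕ → ℤ → Bool
  cornerOfRow i y = isCell n p (column i) y ∨ isCell n p (column i - + 1) y

  cornerOfRow⇒ : ∀ i r → T (cornerOfRow i (+ r)) → CornerOfRow a p r i
  cornerOfRow⇒ i r c with to (T-∨ {isCell n p (column i) (+ r)}) c
  ... | inj₁ right-cell = isCell-column⇒ i r right-cell
  ... | inj₂ left-cell  = isCell-column-1⇒ i r left-cell

  -- At the right end of a row only the cell to the left exists; it is in the row because p ≥ 1.
  cornerOfRow⇐ : ∀ i r → CornerOfRow a p r i → T (cornerOfRow i (+ r))
  cornerOfRow⇐ i r (r≤a , left , right) with i ℕ.<? a ℕ.+ p ℕ.+ r
  ... | yes i<end = from (T-∨ {isCell n p (column i) (+ r)}) (inj₁ (isCell-column⇐ i r r≤a left i<end))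
  ... | no  i≮end = from (T-∨ {isCell n p (column i) (+ r)}) (inj₂ (isCell-column-1⇐ i r r≤a a<i+r right))
    where
      a<i+r : suc a ≤ i ℕ.+ r
      a<i+r = begin
        suc a          ≤⟨ ℕ.+-monoˡ-≤ a 1≤p ⟩
        p ℕ.+ a        ≡⟨ ℕ.+-comm p a ⟩
        a ℕ.+ p        ≤⟨ ℕ.m≤m+n (a ℕ.+ p) r ⟩
        a ℕ.+ p ℕ.+ r  ≤⟨ ℕ.≮⇒≥ i≮end ⟩
        i              ≤⟨ ℕ.m≤m+n i r ⟩
        i ℕ.+ r        ∎
        where open ℕ.≤-Reasoning

  isVertex-emb : ∀ i j → isVertex n p (emb (i , j)) ≡ cornerOfRow i (+ j) ∨ cornerOfRow i (+ j - + 1)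
  isVertex-emb i j = sym (∨-assoc (isCell n p (column i) (+ j)) _ _)

  isVertex⇒Inside : ∀ {u} → T (isVertex n p (emb u)) → Inside a p u
  isVertex⇒Inside {i , zero} v with to (T-∨ {cornerOfRow i (+ 0)}) (subst T (isVertex-emb i 0) v)
  ... | inj₁ c = CornerOfRow⇒Inside (cornerOfRow⇒ i 0 c)
  ... | inj₂ ()
  isVertex⇒Inside {i , suc r} v with to (T-∨ {cornerOfRow i (+ suc r)}) (subst T (isVertex-emb i (suc r)) v)
  ... | inj₁ c = CornerOfRow⇒Inside (cornerOfRow⇒ i (suc r) c)
  ... | inj₂ c = CornerOfRow⇒Inside-above (cornerOfRow⇒ i r c)

  Inside⇒isVertex : ∀ {u} → Inside a p u → T (isVertex n p (emb u))
  Inside⇒isVertex {i , zero} ins = subst T (sym (isVertex-emb i 0))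
    (from (T-∨ {cornerOfRow i (+ 0)}) (inj₁ (cornerOfRow⇐ i 0 (Inside⇒CornerOfRow-bottom ins))))
  Inside⇒isVertex {i , suc r} ins = subst T (sym (isVertex-emb i (suc r)))
    (from (T-∨ {cornerOfRow i (+ suc r)}) (Sum.map (cornerOfRow⇐ i (suc r)) (cornerOfRow⇐ i r) (Inside⇒CornerOfRow ins)))

  candidates-grid : candidates n p ≡ map emb (grid n (2 ℕ.+ a))
  candidates-grid = begin
    candidates n p
      ≡⟨ cong (λ k → concatMap (λ j → map (λ i → (- (+ k) ℤ.+ + i , + j)) (upTo (suc n))) (upTo (2 ℕ.+ k)))
              aOf-n ⟩
    concatMap (λ j → map (λ i → emb (i , j)) (upTo (suc n))) (upTo (2 ℕ.+ a))
      ≡⟨ cong₂ (λ R J → concatMap (λ j → map (λ i → emb (i , j)) R) J)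
               (upTo-range (suc n)) (upTo-range (2 ℕ.+ a)) ⟩
    concatMap (λ j → map (λ i → emb (i , j)) (range 0 (suc n))) (range 0 (2 ℕ.+ a))
      ≡⟨ concatMap-cong (λ j → map-∘ (range 0 (suc n))) (range 0 (2 ℕ.+ a)) ⟩
    concatMap (λ j → map emb (row j (range 0 (suc n)))) (range 0 (2 ℕ.+ a))
      ≡⟨ map-concatMap emb (λ j → row j (range 0 (suc n))) (range 0 (2 ℕ.+ a)) ⟨
    map emb (grid n (2 ℕ.+ a)) ∎
    where open ≡-Reasoning

  vertices-grid : vertices n p ≡ map emb (filter (inside? a p) (grid n (2 ℕ.+ a)))
  vertices-grid = begin
    filter (λ v → T? (isVertex n p v)) (candidates n p)
      ≡⟨ cong (filter (λ v → T? (isVertex n p v))) candidates-grid ⟩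
    filter (λ v → T? (isVertex n p v)) (map emb G)
      ≡⟨ filter-map (λ v → T? (isVertex n p v)) emb G ⟩
    map emb (filter (λ u → T? (isVertex n p (emb u))) G)
      ≡⟨ cong (map emb) (filter-≐ (λ u → T? (isVertex n p (emb u))) (inside? a p)
                                  (isVertex⇒Inside , Inside⇒isVertex) G) ⟩
    map emb (filter (inside? a p) G) ∎
    where
      open ≡-Reasoning
      G = grid n (2 ℕ.+ a)

  vertices-trapezium : vertices n p ≡ map emb (trapezium a p)
  vertices-trapezium = trans vertices-grid (cong (map emb) (filter-inside-grid a p))

  ∈-vertices : ∀ {u} → Inside a p u → emb u ∈ vertices n p
  ∈-vertices {i , j} ins@(j≤a+1 , _ , _ , side) =
    subst (emb (i , j) ∈_) (sym vertices-grid)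
          (∈-map⁺ emb (∈-filter⁺ (inside? a p) (∈-grid n (2 ℕ.+ a) i≤n (s≤s j≤a+1)) ins))
    where
      i≤n : i ≤ n
      i≤n = ℕ.≤-trans side (ℕ.≤-reflexive (a+a+p≡n a p))
        where
          a+a+p≡n : ∀ a p → a ℕ.+ a ℕ.+ p ≡ p ℕ.+ a ℕ.+ a
          a+a+p≡n = ℕ-Solver.solve-∀

module Reachability where

  open import Defs hiding (pairSum)
  open import Data.Nat as ℕ using (ℕ; zero; suc; _≤_; _<_)
  import Data.Nat.Properties as ℕ
  open import Data.Integer as ℤ using (ℤ; +_; -_; _-_; ∣_∣)
  import Data.Integer.Properties as ℤ
  open import Data.Integer.Tactic.RingSolver as ℤ-Solver using ()
  open import Data.Bool using (true; false; T; _∧_)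
  open import Data.Bool.Properties using (T-∧; T-∨)
  open import Data.List.Relation.Unary.Any using (satisfied)
  open import Data.List.Relation.Unary.Any.Properties using (any⁻)
  open import Data.Product using (_×_; _,_; proj₁; proj₂)
  open import Data.Sum using (inj₁; inj₂)
  open import Data.Unit using (tt)
  open import Data.Empty using (⊥-elim)
  open import Function.Bundles using (Equivalence)
  open import Relation.Nullary.Decidable using (toWitness)
  open import Relation.Binary.PropositionalEquality
  open import Algebra.Properties.CommutativeSemigroup ℕ.+-commutativeSemigroup using (interchange)
  open Equivalence using (to)

  manhattanℤ : Point → Point → ℕ
  manhattanℤ (x , y) (x′ , y′) = ∣ x - x′ ∣ ℕ.+ ∣ y - y′ ∣

  ∣-∣-triangle : ∀ x y z → ∣ x - z ∣ ≤ ∣ x - y ∣ ℕ.+ ∣ y - z ∣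
  ∣-∣-triangle x y z =
    subst (λ w → ∣ w ∣ ≤ ∣ x - y ∣ ℕ.+ ∣ y - z ∣) (telescope x y z) (ℤ.∣i+j∣≤∣i∣+∣j∣ (x - y) (y - z))
    where
      telescope : ∀ x y z → (x - y) ℤ.+ (y - z) ≡ x - z
      telescope = ℤ-Solver.solve-∀

  manhattanℤ-triangle : ∀ u w v → manhattanℤ u v ≤ manhattanℤ u w ℕ.+ manhattanℤ w v
  manhattanℤ-triangle (x , y) (x″ , y″) (x′ , y′) =
    ℕ.≤-trans (ℕ.+-mono-≤ (∣-∣-triangle x x″ x′) (∣-∣-triangle y y″ y′))
              (ℕ.≤-reflexive (interchange (∣ x - x″ ∣) (∣ x″ - x′ ∣) (∣ y - y″ ∣) (∣ y″ - y′ ∣)))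

  private
    ∣x-x∣≡0 : ∀ x → ∣ x - x ∣ ≡ 0
    ∣x-x∣≡0 x = cong ∣_∣ (ℤ.+-inverseʳ x)

    ∣x-[x+1]∣≡1 : ∀ x → ∣ x - (x ℤ.+ + 1) ∣ ≡ 1
    ∣x-[x+1]∣≡1 x = cong ∣_∣ (solve x)
      where
        solve : ∀ x → x - (x ℤ.+ + 1) ≡ - + 1
        solve = ℤ-Solver.solve-∀

    manhattanℤ-comm : ∀ u v → manhattanℤ u v ≡ manhattanℤ v u
    manhattanℤ-comm (x , y) (x′ , y′) = cong₂ ℕ._+_ (ℤ.∣i-j∣≡∣j-i∣ x x′) (ℤ.∣i-j∣≡∣j-i∣ y y′)

    horizontal-unit : ∀ u v → proj₂ u ≡ proj₂ v → proj₁ v ≡ proj₁ u ℤ.+ + 1 → manhattanℤ u v ≡ 1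
    horizontal-unit (x , y) _ refl refl = cong₂ ℕ._+_ (∣x-[x+1]∣≡1 x) (∣x-x∣≡0 y)

    vertical-unit : ∀ u v → proj₁ u ≡ proj₁ v → proj₂ v ≡ proj₂ u ℤ.+ + 1 → manhattanℤ u v ≡ 1
    vertical-unit (x , y) _ refl refl = cong₂ ℕ._+_ (∣x-x∣≡0 x) (∣x-[x+1]∣≡1 y)

    T-∧-init : ∀ {e₁ e₂ h} → T (e₁ ∧ e₂ ∧ h) → T e₁ × T e₂
    T-∧-init {e₁} {e₂} t = let t₁ , t′ = to (T-∧ {e₁}) t in t₁ , proj₁ (to (T-∧ {e₂}) t′)

  adj⇒unit : ∀ n p u v → T (adj n p u v) → manhattanℤ u v ≡ 1
  adj⇒unit n p (x , y) (x′ , y′) t with to (T-∨ {(y == y′) ∧ (x′ == x ℤ.+ + 1) ∧ _}) t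
  ... | inj₁ right =
    let y≡y′ , x′≡x+1 = T-∧-init {y == y′} {x′ == x ℤ.+ + 1} right
    in horizontal-unit (x , y) (x′ , y′) (toWitness y≡y′) (toWitness x′≡x+1)
  ... | inj₂ t′ with to (T-∨ {(y == y′) ∧ (x == x′ ℤ.+ + 1) ∧ _}) t′
  ...   | inj₁ left =
    let y≡y′ , x≡x′+1 = T-∧-init {y == y′} {x == x′ ℤ.+ + 1} left
    in trans (manhattanℤ-comm (x , y) (x′ , y′))
             (horizontal-unit (x′ , y′) (x , y) (sym (toWitness y≡y′)) (toWitness x≡x′+1))
  ...   | inj₂ t″ with to (T-∨ {(x == x′) ∧ (y′ == y ℤ.+ + 1) ∧ _}) t″
  ...     | inj₁ up =
    let x≡x′ , y′≡y+1 = T-∧-init {x == x′} {y′ == y ℤ.+ + 1} up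
    in vertical-unit (x , y) (x′ , y′) (toWitness x≡x′) (toWitness y′≡y+1)
  ...     | inj₂ down =
    let x≡x′ , y≡y′+1 = T-∧-init {x == x′} {y == y′ ℤ.+ + 1} down
    in trans (manhattanℤ-comm (x , y) (x′ , y′))
             (vertical-unit (x′ , y′) (x , y) (sym (toWitness x≡x′)) (toWitness y≡y′+1))

  reach-sound : ∀ n p k u v → T (reach n p k u v) → manhattanℤ u v ≤ k
  reach-sound n p zero (x , y) (x′ , y′) same with to (T-∧ {x == x′} {y == y′}) same
  ... | x≡x′ , y≡y′ rewrite toWitness x≡x′ | toWitness y≡y′ = ℕ.≤-reflexive (cong₂ ℕ._+_ (∣x-x∣≡0 x′) (∣x-x∣≡0 y′))
  reach-sound n p (suc k) u v t with to (T-∨ {reach n p k u v}) t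
  ... | inj₁ near = ℕ.m≤n⇒m≤1+n (reach-sound n p k u v near)
  ... | inj₂ via with satisfied (any⁻ (λ w → reach n p k u w ∧ adj n p w v) (vertices n p) via)
  ...   | w , uw∧wv = let uw , wv = to (T-∧ {reach n p k u w}) uw∧wv in begin
    manhattanℤ u v                          ≤⟨ manhattanℤ-triangle u w v ⟩
    manhattanℤ u w ℕ.+ manhattanℤ w v       ≤⟨ ℕ.+-mono-≤ (reach-sound n p k u w uw)
                                                          (ℕ.≤-reflexive (adj⇒unit n p w v wv)) ⟩
    k ℕ.+ 1                                 ≡⟨ ℕ.+-comm k 1 ⟩
    suc k                                   ∎
    where open ℕ.≤-Reasoning

  distFrom-≡ : ∀ n p u v d →
               (∀ k → T (reach n p k u v) → d ≤ k) → (∀ k → d ≤ k → T (reach n p k u v)) →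
               ∀ fuel k → k ≤ d → d < k ℕ.+ fuel → distFrom n p u v k fuel ≡ d
  distFrom-≡ n p u v d sound complete zero k k≤d d<k+0 =
    ⊥-elim (ℕ.<⇒≱ d<k+0 (subst (_≤ d) (sym (ℕ.+-identityʳ k)) k≤d))
  distFrom-≡ n p u v d sound complete (suc fuel) k k≤d d<k+fuel with reach n p k u v in eq
  ... | true  = ℕ.≤-antisym k≤d (sound k (subst T (sym eq) tt))
  ... | false = distFrom-≡ n p u v d sound complete fuel (suc k)
                  (ℕ.≰⇒> (λ d≤k → subst T eq (complete k d≤k)))
                  (subst (d <_) (ℕ.+-suc k fuel) d<k+fuel)

module Distances (a p : ℕ) (1≤p : 1 ≤ p) where

  open import Defs hiding (pairSum)
  open import Data.Nat as ℕ using (ℕ; zero; suc; _≤_; _<_; z≤n; s≤s; ∣_-_∣)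
  import Data.Nat.Properties as ℕ
  open import Data.Nat.Tactic.RingSolver as ℕ-Solver using ()
  open import Data.Integer as ℤ using (ℤ; +_; -_; _-_)
  open import Data.Integer.Tactic.RingSolver as ℤ-Solver using ()
  open import Data.Bool using (T; _∧_; _∨_)
  open import Data.Bool.Properties using (T-∧; T-∨)
  open import Data.Nat.ListAction using (sum)
  open import Data.List using ([]; _∷_; map; length)
  open import Data.List.Properties using (length-map)
  open import Data.List.Relation.Unary.Any.Properties using (any⁺)
  open import Data.List.Membership.Propositional using (lose)
  open import Data.Product using (_×_; _,_; proj₁; proj₂; Σ-syntax)
  open import Data.Sum using (inj₁; inj₂)
  open import Function.Bundles using (Equivalence)
  open import Data.Empty using (⊥-elim)
  open import Relation.Nullary using (yes; no)
  open import Relation.Nullary.Decidable using (fromWitness)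
  open import Relation.Binary using (tri<; tri≈; tri>)
  open import Relation.Binary.PropositionalEquality
  open Equivalence using (to; from)
  open Sums
  open Trapezium
  open Grid
  open Vertices a p 1≤p
  open Reachability
  open NaturalDifferences using (∣+m-+n∣)

  Defs-pairSum : ∀ (d : Point → Point → ℕ) xs → Defs.pairSum d xs ≡ pairSum d xs
  Defs-pairSum d []       = refl
  Defs-pairSum d (x ∷ xs) = cong (sum (map (d x) xs) ℕ.+_) (Defs-pairSum d xs)

  manhattanℤ-emb : ∀ u v → manhattanℤ (emb u) (emb v) ≡ manhattan u v
  manhattanℤ-emb (i , j) (i′ , j′) =
    cong₂ ℕ._+_ (trans (cong ℤ.∣_∣ (shift (+ a) (+ i) (+ i′))) (∣+m-+n∣ i i′)) (∣+m-+n∣ j j′)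
    where
      shift : ∀ x y z → (- x ℤ.+ y) - (- x ℤ.+ z) ≡ y - z
      shift = ℤ-Solver.solve-∀

  column-suc : ∀ i → column (suc i) ≡ column i ℤ.+ + 1
  column-suc i = trans (cong (λ k → - (+ a) ℤ.+ + k) (ℕ.+-comm 1 i)) (solve (+ a) (+ i))
    where
      solve : ∀ x y → - x ℤ.+ (y ℤ.+ + 1) ≡ - x ℤ.+ y ℤ.+ + 1
      solve = ℤ-Solver.solve-∀

  horizontal-cells : ∀ {i j} → Inside a p (i , j) → Inside a p (suc i , j) →
                     T (isCell n p (column i) (+ j) ∨ isCell n p (column i) (+ j - + 1))
  horizontal-cells {i} {j} (j≤a+1 , left , _ , _) (_ , _ , right , side) with j ℕ.≤? a
  ... | yes j≤a = from T-∨ (inj₁ (isCell-column⇐ i j j≤a left right))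
  ... | no  j≰a = subst (λ k → T (isCell n p (column i) (+ k) ∨ isCell n p (column i) (+ k - + 1))) (sym j≡a+1)
                         (from T-∨ (inj₂ (isCell-column⇐ i a ℕ.≤-refl (ℕ.m≤n+m a i) i<end)))
    where
      j≡a+1 : j ≡ suc a
      j≡a+1 = ℕ.≤-antisym j≤a+1 (ℕ.≰⇒> j≰a)
      i<end : i < a ℕ.+ p ℕ.+ a
      i<end = ℕ.≤-trans side (ℕ.≤-reflexive (reorder a p))
        where
          reorder : ∀ a p → a ℕ.+ a ℕ.+ p ≡ a ℕ.+ p ℕ.+ a
          reorder = ℕ-Solver.solve-∀

  private
    T-∧³ : ∀ {e₁ e₂ h} → T e₁ → T e₂ → T h → T (e₁ ∧ e₂ ∧ h)
    T-∧³ {e₁} {e₂} t₁ t₂ t₃ = from (T-∧ {e₁}) (t₁ , from (T-∧ {e₂}) (t₂ , t₃))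

    vertical-cells : ∀ {i j} → Inside a p (i , j) → Inside a p (i , suc j) → T (cornerOfRow i (+ j))
    vertical-cells {i} {j} (_ , left , right , _) (j<a+1 , _ , _ , _) = cornerOfRow⇐ i j (ℕ.≤-pred j<a+1 , left , right)

    horizontal-step : ∀ {i j} → Inside a p (i , j) → Inside a p (suc i , j) →
      T ((+ j == + j) ∧ (column (suc i) == column i ℤ.+ + 1)
         ∧ (isCell n p (column i) (+ j) ∨ isCell n p (column i) (+ j - + 1)))
    horizontal-step {i} {j} u v =
      T-∧³ {+ j == + j} {column (suc i) == column i ℤ.+ + 1}
           (fromWitness refl) (fromWitness (column-suc i)) (horizontal-cells u v)

    vertical-step : ∀ {i j} → Inside a p (i , j) → Inside a p (i , suc j) →
      T ((column i == column i) ∧ (+ suc j == + j ℤ.+ + 1) ∧ cornerOfRow i (+ j))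
    vertical-step {i} {j} u v =
      T-∧³ {column i == column i} {+ suc j == + j ℤ.+ + 1}
           (fromWitness refl) (fromWitness (cong +_ (ℕ.+-comm 1 j))) (vertical-cells u v)

  edge-right : ∀ {i j} → Inside a p (i , j) → Inside a p (suc i , j) →
               T (adj n p (emb (i , j)) (emb (suc i , j)))
  edge-right {i} {j} u v = from (T-∨ {(+ j == + j) ∧ _}) (inj₁ (horizontal-step u v))

  edge-left : ∀ {i j} → Inside a p (i , j) → Inside a p (suc i , j) →
              T (adj n p (emb (suc i , j)) (emb (i , j)))
  edge-left {i} {j} u v =
    from (T-∨ {(+ j == + j) ∧ _}) (inj₂ (from (T-∨ {(+ j == + j) ∧ _}) (inj₁ (horizontal-step u v))))

  edge-up : ∀ {i j} → Inside a p (i , j) → Inside a p (i , suc j) →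
            T (adj n p (emb (i , j)) (emb (i , suc j)))
  edge-up {i} {j} u v =
    from (T-∨ {(+ j == + suc j) ∧ _}) (inj₂ (from (T-∨ {(+ j == + suc j) ∧ _}) (inj₂
      (from (T-∨ {(column i == column i) ∧ _}) (inj₁ (vertical-step u v))))))

  edge-down : ∀ {i j} → Inside a p (i , j) → Inside a p (i , suc j) →
              T (adj n p (emb (i , suc j)) (emb (i , j)))
  edge-down {i} {j} u v =
    from (T-∨ {(+ suc j == + j) ∧ _}) (inj₂ (from (T-∨ {(+ suc j == + j) ∧ _}) (inj₂
      (from (T-∨ {(column i == column i) ∧ _}) (inj₂ (vertical-step u v))))))

  private
    ∣m-1+n∣≡1+∣m-n∣ : ∀ {m n} → m ≤ n → ∣ m - suc n ∣ ≡ suc ∣ m - n ∣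
    ∣m-1+n∣≡1+∣m-n∣ {zero}              _         = refl
    ∣m-1+n∣≡1+∣m-n∣ {suc m} {suc n}     (s≤s m≤n) = ∣m-1+n∣≡1+∣m-n∣ m≤n

    ∣m-n∣≡1+∣m-1+n∣ : ∀ {m n} → n < m → ∣ m - n ∣ ≡ suc ∣ m - suc n ∣
    ∣m-n∣≡1+∣m-1+n∣ {suc m} {n} (s≤s n≤m) =
      trans (ℕ.∣-∣-comm (suc m) n) (trans (∣m-1+n∣≡1+∣m-n∣ n≤m) (cong suc (ℕ.∣-∣-comm n m)))

    +-suc-injective : ∀ x y {k} → x ℕ.+ suc y ≡ suc k → x ℕ.+ y ≡ k
    +-suc-injective x y e = ℕ.suc-injective (trans (sym (ℕ.+-suc x y)) e)

  Predecessor : ℕ × ℕ → ℕ × ℕ → ℕ → Set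
  Predecessor u v k = Σ[ w ∈ ℕ × ℕ ] Inside a p w × manhattan u w ≡ k × T (adj n p (emb w) (emb v))

  private
    from-above : ∀ {i j i′ j′ k} → j′ < j → Inside a p (i , j) → Inside a p (i′ , j′) →
                 manhattan (i , j) (i′ , j′) ≡ suc k → Predecessor (i , j) (i′ , j′) k
    from-above {i} {j} {i′} {j′} j′<j hu hv d≡1+k =
      (i′ , suc j′) , hw ,
      +-suc-injective ∣ i - i′ ∣ _ (trans (cong (∣ i - i′ ∣ ℕ.+_) (sym (∣m-n∣≡1+∣m-1+n∣ j′<j))) d≡1+k) ,
      edge-down hv hw
      where hw = Inside-up hv (ℕ.n≤1+n j′) (ℕ.≤-trans j′<j (proj₁ hu))

    from-left : ∀ {i j i′ j′ k} → i < i′ → j ≤ j′ → Inside a p (i , j) → Inside a p (i′ , j′) →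
                manhattan (i , j) (i′ , j′) ≡ suc k → Predecessor (i , j) (i′ , j′) k
    from-left {i} {j} {suc i″} {j′} (s≤s i≤i″) j≤j′ hu hv d≡1+k =
      (i″ , j′) , hw ,
      ℕ.suc-injective (trans (cong (ℕ._+ ∣ j - j′ ∣) (sym (∣m-1+n∣≡1+∣m-n∣ i≤i″))) d≡1+k) ,
      edge-right hw hv
      where hw = Inside-between (Inside-up hu j≤j′ (proj₁ hv)) hv i≤i″ (ℕ.n≤1+n i″)

    from-right : ∀ {i j i′ j′ k} → i′ < i → j ≤ j′ → Inside a p (i , j) → Inside a p (i′ , j′) →
                 manhattan (i , j) (i′ , j′) ≡ suc k → Predecessor (i , j) (i′ , j′) k
    from-right {i} {j} {i′} {j′} i′<i j≤j′ hu hv d≡1+k =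
      (suc i′ , j′) , hw ,
      ℕ.suc-injective (trans (cong (ℕ._+ ∣ j - j′ ∣) (sym (∣m-n∣≡1+∣m-1+n∣ i′<i))) d≡1+k) ,
      edge-left hv hw
      where hw = Inside-between hv (Inside-up hu j≤j′ (proj₁ hv)) (ℕ.n≤1+n i′) i′<i

    from-below : ∀ {i j j′ k} → j ≤ j′ → Inside a p (i , j) → Inside a p (i , j′) →
                 manhattan (i , j) (i , j′) ≡ suc k → Predecessor (i , j) (i , j′) k
    from-below {i} {j} {j′} j≤j′ hu hv d≡1+k with ℕ.m≤n⇒m<n∨m≡n j≤j′
    ... | inj₂ refl = ⊥-elim (ℕ.0≢1+n (trans (sym (cong₂ ℕ._+_ (ℕ.∣n-n∣≡0 i) (ℕ.∣n-n∣≡0 j))) d≡1+k))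
    ... | inj₁ (s≤s j≤j″) =
      (i , _) , hw ,
      +-suc-injective ∣ i - i ∣ _ (trans (cong (∣ i - i ∣ ℕ.+_) (sym (∣m-1+n∣≡1+∣m-n∣ j≤j″))) d≡1+k) ,
      edge-up hw hv
      where hw = Inside-up hu j≤j″ (ℕ.≤-trans (ℕ.n≤1+n _) (proj₁ hv))

  -- The last step of a monotone lattice path from u to v: from above v if v is below u, otherwise
  -- horizontally from u's side, otherwise from below; convexity of the rows keeps it inside.
  predecessor : ∀ u v k → Inside a p u → Inside a p v → manhattan u v ≡ suc k → Predecessor u v k
  predecessor (i , j) (i′ , j′) k hu hv d≡1+k with j′ ℕ.<? j | ℕ.<-cmp i i′
  ... | yes j′<j | _             = from-above j′<j hu hv d≡1+k
  ... | no  j′≮j | tri< i<i′ _ _ = from-left i<i′ (ℕ.≮⇒≥ j′≮j) hu hv d≡1+k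
  ... | no  j′≮j | tri> _ _ i′<i = from-right i′<i (ℕ.≮⇒≥ j′≮j) hu hv d≡1+k
  ... | no  j′≮j | tri≈ _ refl _ = from-below (ℕ.≮⇒≥ j′≮j) hu hv d≡1+k

  reach-complete : ∀ k u v → Inside a p u → Inside a p v → manhattan u v ≤ k →
                   T (reach n p k (emb u) (emb v))
  reach-complete zero (i , j) (i′ , j′) _ _ d≤0 =
    subst (λ w → T (samePt (emb (i , j)) (emb w))) (cong₂ _,_ i≡i′ j≡j′)
          (from (T-∧ {column i == column i}) (fromWitness refl , fromWitness refl))
    where
      d≡0 = ℕ.n≤0⇒n≡0 d≤0
      i≡i′ = ℕ.∣m-n∣≡0⇒m≡n (ℕ.m+n≡0⇒m≡0 ∣ i - i′ ∣ d≡0)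
      j≡j′ = ℕ.∣m-n∣≡0⇒m≡n (ℕ.m+n≡0⇒n≡0 ∣ i - i′ ∣ d≡0)
  reach-complete (suc k) u v hu hv d≤1+k with manhattan u v ℕ.≤? k
  ... | yes d≤k = from (T-∨ {reach n p k (emb u) (emb v)}) (inj₁ (reach-complete k u v hu hv d≤k))
  ... | no  d≰k with predecessor u v k hu hv (ℕ.≤-antisym d≤1+k (ℕ.≰⇒> d≰k))
  ...   | w , hw , d≡k , wv = from (T-∨ {reach n p k (emb u) (emb v)}) (inj₂
          (any⁺ (λ w′ → reach n p k (emb u) w′ ∧ adj n p w′ (emb v)) (lose (∈-vertices hw) uw∧wv)))
    where
      uw∧wv : T (reach n p k (emb u) (emb w) ∧ adj n p (emb w) (emb v))
      uw∧wv = from (T-∧ {reach n p k (emb u) (emb w)}) (reach-complete k u w hu hw (ℕ.≤-reflexive d≡k) , wv)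

  numV-n : numV n p ≡ vertexPoly a p
  numV-n = trans (cong length vertices-trapezium)
                 (trans (length-map emb (trapezium a p)) (length-trapezium a p))

  manhattan<vertexPoly : ∀ {u v} → Inside a p u → Inside a p v → manhattan u v < vertexPoly a p
  manhattan<vertexPoly {i , j} {i′ , j′} (j≤ , _ , _ , i≤) (j′≤ , _ , _ , i′≤) = begin-strict
    ∣ i - i′ ∣ ℕ.+ ∣ j - j′ ∣          ≤⟨ ℕ.+-mono-≤ (ℕ.≤-trans (ℕ.∣m-n∣≤m⊔n i i′) (ℕ.⊔-lub i≤ i′≤))
                                                    (ℕ.≤-trans (ℕ.∣m-n∣≤m⊔n j j′) (ℕ.⊔-lub j≤ j′≤)) ⟩
    a ℕ.+ a ℕ.+ p ℕ.+ suc a           <⟨ ℕ.m≤m+n _ _ ⟩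
    suc (a ℕ.+ a ℕ.+ p ℕ.+ suc a) ℕ.+ (p ℕ.+ a ℕ.+ a ℕ.* p ℕ.+ a ℕ.* a) ≡⟨ expand a p ⟩
    vertexPoly a p                     ∎
    where
      open ℕ.≤-Reasoning
      expand : ∀ a p →
               suc (a ℕ.+ a ℕ.+ p ℕ.+ suc a) ℕ.+ (p ℕ.+ a ℕ.+ a ℕ.* p ℕ.+ a ℕ.* a) ≡ vertexPoly a p
      expand = ℕ-Solver.solve-∀

  -- dist only looks for walks shorter than numV n p, hence the bound manhattan<vertexPoly.
  dist-emb : ∀ {u v} → Inside a p u → Inside a p v → dist n p (emb u) (emb v) ≡ manhattan u v
  dist-emb {u} {v} hu hv =
    distFrom-≡ n p (emb u) (emb v) (manhattan u v)
      (λ k r → subst (_≤ k) (manhattanℤ-emb u v) (reach-sound n p k (emb u) (emb v) r))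
      (λ k d≤k → reach-complete k u v hu hv d≤k)
      (numV n p) 0 z≤n (subst (manhattan u v <_) (sym numV-n) (manhattan<vertexPoly hu hv))

  wiener-n : wiener n p ≡ pairSum manhattan (trapezium a p)
  wiener-n = begin
    Defs.pairSum (dist n p) (vertices n p)       ≡⟨ Defs-pairSum (dist n p) (vertices n p) ⟩
    pairSum (dist n p) (vertices n p)            ≡⟨ cong (pairSum (dist n p)) vertices-trapezium ⟩
    pairSum (dist n p) (map emb (trapezium a p)) ≡⟨ pairSum-map (dist n p) emb (trapezium a p) ⟩
    pairSum (λ u v → dist n p (emb u) (emb v)) (trapezium a p)
      ≡⟨ pairSum-cong-All (Inside a p) dist-emb (All-Inside-trapezium a p) ⟩
    pairSum manhattan (trapezium a p) ∎
    where open ≡-Reasoning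

module Rationals where

  open import Defs using (_÷'_)
  open import Data.Integer as ℤ using (ℤ; +_)
  import Data.Integer.Properties as ℤ
  open import Data.Rational as ℚ using (ℚ; 0ℚ; 1ℚ; _÷_; _/_; 1/_; toℚᵘ)
  import Data.Rational.Properties as ℚ
  import Data.Rational.Unnormalised as ℚᵘ
  import Data.Rational.Unnormalised.Properties as ℚᵘ
  open import Algebra.Bundles using (CommutativeMonoid)
  open CommutativeMonoid ℚ.*-1-commutativeMonoid using ()
    renaming (commutativeSemigroup to ℚ*-commutativeSemigroup)
  open import Algebra.Properties.CommutativeSemigroup ℚ*-commutativeSemigroup using (interchange)
  open import Data.Empty using (⊥-elim)
  open import Relation.Nullary using (yes; no)
  open import Relation.Binary.PropositionalEquality

  toℚᵘ-/1 : ∀ x → toℚᵘ (x / 1) ℚᵘ.≃ ℚᵘ.mkℚᵘ x 0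
  toℚᵘ-/1 x = ℚ.toℚᵘ-fromℚᵘ (ℚᵘ.mkℚᵘ x 0)

  /1-* : ∀ x y → (x / 1) ℚ.* (y / 1) ≡ (x ℤ.* y) / 1
  /1-* x y = ℚ.toℚᵘ-injective (begin
    toℚᵘ ((x / 1) ℚ.* (y / 1))          ≈⟨ ℚ.toℚᵘ-homo-* (x / 1) (y / 1) ⟩
    toℚᵘ (x / 1) ℚᵘ.* toℚᵘ (y / 1)     ≈⟨ ℚᵘ.*-cong (toℚᵘ-/1 x) (toℚᵘ-/1 y) ⟩
    ℚᵘ.mkℚᵘ (x ℤ.* y) 0                ≈⟨ toℚᵘ-/1 (x ℤ.* y) ⟨
    toℚᵘ ((x ℤ.* y) / 1)               ∎)
    where open ℚᵘ.≃-Reasoning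

  /1-≢0 : ∀ y → y ≢ + 0 → y / 1 ≢ 0ℚ
  /1-≢0 y y≢0 y/1≡0 with ℚᵘ.≃-trans (ℚᵘ.≃-sym (toℚᵘ-/1 y)) (ℚᵘ.≃-reflexive (cong toℚᵘ y/1≡0))
  ... | ℚᵘ.*≡* y*1≡0 = y≢0 (trans (sym (ℤ.*-identityʳ y)) y*1≡0)

  ÷-cross : ∀ x y x′ y′ .{{_ : ℚ.NonZero y}} .{{_ : ℚ.NonZero y′}} →
            x ℚ.* y′ ≡ x′ ℚ.* y → x ÷ y ≡ x′ ÷ y′
  ÷-cross x y x′ y′ cross = begin
    x ℚ.* 1/ y                                ≡⟨ ℚ.*-identityʳ _ ⟨
    x ℚ.* 1/ y ℚ.* 1ℚ                         ≡⟨ cong (x ℚ.* 1/ y ℚ.*_) (ℚ.*-inverseʳ y′) ⟨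
    x ℚ.* 1/ y ℚ.* (y′ ℚ.* 1/ y′)             ≡⟨ interchange x (1/ y) y′ (1/ y′) ⟩
    x ℚ.* y′ ℚ.* (1/ y ℚ.* 1/ y′)             ≡⟨ cong₂ ℚ._*_ cross (ℚ.*-comm (1/ y) (1/ y′)) ⟩
    x′ ℚ.* y ℚ.* (1/ y′ ℚ.* 1/ y)             ≡⟨ interchange x′ y (1/ y′) (1/ y) ⟩
    x′ ℚ.* 1/ y′ ℚ.* (y ℚ.* 1/ y)             ≡⟨ cong (x′ ℚ.* 1/ y′ ℚ.*_) (ℚ.*-inverseʳ y) ⟩
    x′ ℚ.* 1/ y′ ℚ.* 1ℚ                       ≡⟨ ℚ.*-identityʳ _ ⟩
    x′ ℚ.* 1/ y′                              ∎
    where open ≡-Reasoning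

  ÷′-cross : ∀ x y x′ y′ → y ≢ + 0 → y′ ≢ + 0 → x ℤ.* y′ ≡ x′ ℤ.* y →
             (x / 1) ÷' (y / 1) ≡ (x′ / 1) ÷' (y′ / 1)
  ÷′-cross x y x′ y′ y≢0 y′≢0 cross with y / 1 ℚ.≟ 0ℚ | y′ / 1 ℚ.≟ 0ℚ
  ... | yes y≡0 | _        = ⊥-elim (/1-≢0 y y≢0 y≡0)
  ... | no _    | yes y′≡0 = ⊥-elim (/1-≢0 y′ y′≢0 y′≡0)
  ... | no y≢0′ | no y′≢0′ =
    ÷-cross (x / 1) (y / 1) (x′ / 1) (y′ / 1) {{ℚ.≢-nonZero y≢0′}} {{ℚ.≢-nonZero y′≢0′}}
            (trans (/1-* x y′) (trans (cong (_/ 1) cross) (sym (/1-* x′ y))))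

module Cast where

  open import Data.Nat as ℕ using (ℕ)
  open import Data.Integer as ℤ using (ℤ; +_)
  import Data.Integer.Properties as ℤ
  open import Data.Product using (Σ-syntax; _,_; proj₂)
  open import Relation.Binary.PropositionalEquality

  -- Natural numbers paired with their images in ℤ: evaluating a polynomial here
  -- shows that +_ commutes with it.
  Cast : Set
  Cast = Σ[ m ∈ ℕ ] Σ[ z ∈ ℤ ] + m ≡ z

  _+ᶜ_ _*ᶜ_ : Cast → Cast → Cast
  (m , z , e) +ᶜ (m′ , z′ , e′) = m ℕ.+ m′ , z ℤ.+ z′ , trans (ℤ.pos-+ m m′) (cong₂ ℤ._+_ e e′)
  (m , z , e) *ᶜ (m′ , z′ , e′) = m ℕ.* m′ , z ℤ.* z′ , trans (ℤ.pos-* m m′) (cong₂ ℤ._*_ e e′)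

  ↑ : ℕ → Cast
  ↑ m = m , + m , refl

  module ℕ-Poly = Polynomials ℕ._+_ ℕ._*_ (λ c → c)
  module ℤ-Poly = Polynomials ℤ._+_ ℤ._*_ +_
  module C-Poly = Polynomials _+ᶜ_ _*ᶜ_ ↑

  +-vertexPoly : ∀ a p → + ℕ-Poly.vertexPoly a p ≡ ℤ-Poly.vertexPoly (+ a) (+ p)
  +-vertexPoly a p = proj₂ (proj₂ (C-Poly.vertexPoly (↑ a) (↑ p)))

  +-wienerPoly : ∀ a p → + ℕ-Poly.wienerPoly a p ≡ ℤ-Poly.wienerPoly (+ a) (+ p)
  +-wienerPoly a p = proj₂ (proj₂ (C-Poly.wienerPoly (↑ a) (↑ p)))

module AverageDistance where

  open import Defs hiding (pairSum)
  open import Data.Nat as ℕ using (ℕ; _≤_; _∸_)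
  import Data.Nat.Properties as ℕ
  open import Data.Nat.Divisibility using (_∣_; divides; quotient)
  open import Data.Nat.Tactic.RingSolver as ℕ-Solver using ()
  open import Data.Integer as ℤ using (ℤ; +_; _+_; _-_; _*_)
  import Data.Integer.Properties as ℤ
  open import Data.Integer.Tactic.RingSolver as ℤ-Solver using ()
  open import Data.Rational using (_/_)
  open import Data.Sum using (inj₂)
  open import Relation.Binary.PropositionalEquality
  open Sums using (pairSum)
  open Trapezium using (trapezium; manhattan; vertexPoly; wiener-trapezium)
  open Rationals using (÷′-cross)
  open Cast using (module ℤ-Poly; +-vertexPoly; +-wienerPoly)

  numerator : ℤ → ℤ → ℤ
  numerator n p =
    + 11 * (n * n * n * n * n)
      + + 220 * (n * n * n * n)
      - + 30 * (n * n * n) * (p * p)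
      + + 1400 * (n * n * n)
      + + 20 * (n * n) * (p * p * p)
      - + 360 * (n * n) * (p * p)
      - + 20 * (n * n) * p
      + + 3440 * (n * n)
      - + 5 * n * (p * p * p * p)
      + + 160 * n * (p * p * p)
      - + 880 * n * (p * p)
      - + 160 * n * p
      + + 3344 * n
      + + 4 * (p * p * p * p * p)
      - + 20 * (p * p * p * p)
      + + 140 * (p * p * p)
      - + 400 * (p * p)
      - + 144 * p
      + + 960
  {-# INLINE numerator #-}

  denominator : ℤ → ℤ → ℤ
  denominator n p = + 30 * (n * n + + 8 * n - p * p + + 4) * (n * n + + 8 * n - p * p + + 8)
  {-# INLINE denominator #-}

  n≡p+2a : ∀ {n p} → p ≤ n → (2∣n∸p : 2 ∣ n ∸ p) → n ≡ p ℕ.+ quotient 2∣n∸p ℕ.+ quotient 2∣n∸p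
  n≡p+2a {n} {p} p≤n (divides a n∸p≡a*2) = begin
    n                   ≡⟨ ℕ.m+[n∸m]≡n p≤n ⟨
    p ℕ.+ (n ∸ p)       ≡⟨ cong (p ℕ.+_) n∸p≡a*2 ⟩
    p ℕ.+ a ℕ.* 2       ≡⟨ twice p a ⟩
    p ℕ.+ a ℕ.+ a       ∎
    where
      open ≡-Reasoning
      twice : ∀ p a → p ℕ.+ a ℕ.* 2 ≡ p ℕ.+ a ℕ.+ a
      twice = ℕ-Solver.solve-∀

  numerator-wienerPoly : ∀ α π → numerator (π + α + α) π ≡ + 16 * ℤ-Poly.wienerPoly α π
  numerator-wienerPoly = ℤ-Solver.solve-∀

  denominator-vertexPoly : ∀ α π →
    denominator (π + α + α) π ≡ + 480 * (ℤ-Poly.vertexPoly α π * (ℤ-Poly.vertexPoly α π - + 1))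
  denominator-vertexPoly = ℤ-Solver.solve-∀

  ordered-pairs : ∀ a p →
    + (vertexPoly a p ℕ.* (vertexPoly a p ∸ 1)) ≡ ℤ-Poly.vertexPoly (+ a) (+ p) * (ℤ-Poly.vertexPoly (+ a) (+ p) - + 1)
  ordered-pairs a p =
    trans (ℤ.pos-* N (N ∸ 1)) (cong₂ _*_ (+-vertexPoly a p) (trans (pred-+ (+ (N ∸ 1))) (cong (_- + 1) (+-vertexPoly a p))))
    where
      N = vertexPoly a p
      pred-+ : ∀ x → x ≡ + 1 + x - + 1
      pred-+ = ℤ-Solver.solve-∀

  denominator-pairs : ∀ a p →
    denominator (+ (p ℕ.+ a ℕ.+ a)) (+ p) ≡ + 480 * + (vertexPoly a p ℕ.* (vertexPoly a p ∸ 1))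
  denominator-pairs a p = trans (denominator-vertexPoly (+ a) (+ p)) (cong (+ 480 *_) (sym (ordered-pairs a p)))

  cross-multiplied : ∀ a p →
    + (2 ℕ.* pairSum manhattan (trapezium a p)) * denominator (+ (p ℕ.+ a ℕ.+ a)) (+ p)
      ≡ numerator (+ (p ℕ.+ a ℕ.+ a)) (+ p) * + (vertexPoly a p ℕ.* (vertexPoly a p ∸ 1))
  cross-multiplied a p = begin
    + (2 ℕ.* W) * denominator (+ n) (+ p)  ≡⟨ cong₂ _*_ (ℤ.pos-* 2 W) (denominator-pairs a p) ⟩
    + 2 * + W * (+ 480 * Y)                ≡⟨ regroup (+ W) Y ⟩
    + 16 * (+ 60 * + W) * Y                ≡⟨ cong (λ w → + 16 * w * Y) sixty-W ⟩
    + 16 * ℤ-Poly.wienerPoly (+ a) (+ p) * Y ≡⟨ cong (_* Y) (numerator-wienerPoly (+ a) (+ p)) ⟨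
    numerator (+ n) (+ p) * Y              ∎
    where
      open ≡-Reasoning
      n = p ℕ.+ a ℕ.+ a
      W = pairSum manhattan (trapezium a p)
      Y = + (vertexPoly a p ℕ.* (vertexPoly a p ∸ 1))
      regroup : ∀ w y → + 2 * w * (+ 480 * y) ≡ + 16 * (+ 60 * w) * y
      regroup = ℤ-Solver.solve-∀
      sixty-W : + 60 * + W ≡ ℤ-Poly.wienerPoly (+ a) (+ p)
      sixty-W = trans (sym (ℤ.pos-* 60 W)) (trans (cong +_ (wiener-trapezium a p)) (+-wienerPoly a p))

  avgDist-trapezium : ∀ a p → 1 ≤ p →
    avgDist (p ℕ.+ a ℕ.+ a) p
      ≡ (numerator (+ (p ℕ.+ a ℕ.+ a)) (+ p) / 1) ÷' (denominator (+ (p ℕ.+ a ℕ.+ a)) (+ p) / 1)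
  avgDist-trapezium a p 1≤p = begin
    (+ (2 ℕ.* wiener n p) / 1) ÷' (+ (numV n p ℕ.* (numV n p ∸ 1)) / 1)
      ≡⟨ cong₂ (λ W N → (+ (2 ℕ.* W) / 1) ÷' (+ (N ℕ.* (N ∸ 1)) / 1)) wiener-n numV-n ⟩
    (+ (2 ℕ.* pairSum manhattan (trapezium a p)) / 1) ÷' (Y / 1)
      ≡⟨ ÷′-cross (+ (2 ℕ.* pairSum manhattan (trapezium a p))) Y (numerator (+ n) (+ p)) (denominator (+ n) (+ p))
                  Y≢0 denominator≢0 (cross-multiplied a p) ⟩
    (numerator (+ n) (+ p) / 1) ÷' (denominator (+ n) (+ p) / 1) ∎
    where
      open ≡-Reasoning
      open Vertices a p 1≤p using (n)
      open Distances a p 1≤p using (wiener-n; numV-n)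
      Y = + (vertexPoly a p ℕ.* (vertexPoly a p ∸ 1))
      Y≢0 : Y ≢ + 0
      Y≢0 ()
      denominator≢0 : denominator (+ n) (+ p) ≢ + 0
      denominator≢0 den≡0 with ℤ.i*j≡0⇒i≡0∨j≡0 (+ 480) (trans (sym (denominator-pairs a p)) den≡0)
      ... | inj₂ Y≡0 = Y≢0 Y≡0

open import Defs
open import Data.Nat using (ℕ; _≤_; _∸_)
open import Data.Nat.Divisibility using (_∣_)
open import Data.Integer using (+_; _+_; _-_; _*_)
open import Data.Rational using (_/_)
open import Relation.Binary.PropositionalEquality using (_≡_)

mainTheorem7 : (n p : ℕ) → 1 ≤ n → 1 ≤ p → p ≤ n → 2 ∣ (n ∸ p) →
  avgDist n p ≡
    ((+ 11 * (+ n * + n * + n * + n * + n)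
      + + 220 * (+ n * + n * + n * + n)
      - + 30 * (+ n * + n * + n) * (+ p * + p)
      + + 1400 * (+ n * + n * + n)
      + + 20 * (+ n * + n) * (+ p * + p * + p)
      - + 360 * (+ n * + n) * (+ p * + p)
      - + 20 * (+ n * + n) * + p
      + + 3440 * (+ n * + n)
      - + 5 * + n * (+ p * + p * + p * + p)
      + + 160 * + n * (+ p * + p * + p)
      - + 880 * + n * (+ p * + p)
      - + 160 * + n * + p
      + + 3344 * + n
      + + 4 * (+ p * + p * + p * + p * + p)
      - + 20 * (+ p * + p * + p * + p)
      + + 140 * (+ p * + p * + p)
      - + 400 * (+ p * + p)
      - + 144 * + p
      + + 960) / 1)
    ÷' ((+ 30 * (+ n * + n + + 8 * + n - + p * + p + + 4)
              * (+ n * + n + + 8 * + n - + p * + p + + 8)) / 1)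
mainTheorem7 n p _ 1≤p p≤n 2∣n∸p =
  subst (λ m → avgDist m p ≡ (numerator (+ m) (+ p) / 1) ÷' (denominator (+ m) (+ p) / 1))
        (sym (n≡p+2a p≤n 2∣n∸p)) (avgDist-trapezium (quotient 2∣n∸p) p 1≤p)
  where
    open import Relation.Binary.PropositionalEquality using (subst; sym)
    open Data.Nat.Divisibility._∣_ using (quotient)
    open AverageDistance using (numerator; denominator; n≡p+2a; avgDist-trapezium)
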